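{- The ceer $\omega^{(\omega)}$ is universal: for every ceer $R$, $R\leq\omega^{(\omega)}$.
   Context: A ceer is an equivalence relation on $\mathbb N$ which is computably enumerable as a subset of $\mathbb N^2$. For ceers $R_1,R_2$, $R_1\leq R_2$ means there is a total computable $f$ with $xR_1y\Leftrightarrow f(x)R_2f(y)$ for all $x,y$. Let $\varphi_e$ be the standard enumeration of partial computable functions, $\kappa(x)=\varphi_x(x)$ (partial), and $\kappa^i$ its $i$-th iterate ($\kappa^0$ the identity). The ceer $\omega^{(\omega)}$ is defined by $x\,\omega^{(\omega)}\,y\Leftrightarrow\exists i\,(\kappa^i(x)\!\downarrow\,=\kappa^i(y)\!\downarrow)$. -}

module Defs where

open import Level using (0ℓ)
open import Data.Nat using (ℕ; zero; suc; _≡ᵇ_)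
open import Data.Bool using (if_then_else_)
open import Data.List using (List; []; _∷_; map)
open import Data.Maybe using (Maybe; just; nothing)
open import Data.Product using (Σ; ∃; ∃-syntax; _×_; _,_)
open import Relation.Binary.PropositionalEquality using (_≡_)
open import Relation.Binary using (Rel; IsEquivalence)
open import Function.Bundles using (_⇔_)

-- Coding: Cantor enumeration of ℕ × ℕ (a bijection ℕ → ℕ × ℕ)

next : ℕ × ℕ → ℕ × ℕ
next (a , zero)  = (zero , suc a)
next (a , suc b) = (suc a , b)

unpair : ℕ → ℕ × ℕ
unpair zero    = (zero , zero)
unpair (suc n) = next (unpair n)

-- Decoding of a natural number as a finite list of naturals
-- (0 ↦ [], suc n ↦ h ∷ decode t where unpair n = (h , t)); fuel n suffices.
decodeListF : ℕ → ℕ → List ℕ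
decodeListF zero       _       = []
decodeListF (suc fuel) zero    = []
decodeListF (suc fuel) (suc n) with unpair n
... | (h , t) = h ∷ decodeListF fuel t

decodeList : ℕ → List ℕ
decodeList n = decodeListF n n

-- Model of computation: counter (register) machines.
-- inc i   : R_i := R_i + 1, go to next instruction
-- dec i j : if R_i = 0 jump to instruction j, else R_i := R_i - 1 and
--           go to next instruction
-- The machine halts when the program counter leaves the program;
-- input in R_0 (all other registers 0), output read from R_0.

data Instr : Set where
  inc : ℕ → Instr
  dec : ℕ → ℕ → Instr

decodeInstr : ℕ → Instr
decodeInstr n with unpair n
... | (zero  , b) = inc b
... | (suc _ , b) with unpair b
...   | (i , j) = dec i j

Prog : Set
Prog = List Instr

-- the program with Gödel number e (every number codes a program,
-- every program has a code)
prog : ℕ → Prog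
prog e = map decodeInstr (decodeList e)

fetch : Prog → ℕ → Maybe Instr
fetch []       _       = nothing
fetch (x ∷ p)  zero    = just x
fetch (x ∷ p)  (suc k) = fetch p k

Regs : Set
Regs = ℕ → ℕ

update : Regs → ℕ → ℕ → Regs
update r i v j = if j ≡ᵇ i then v else r j

run : ℕ → Prog → ℕ → Regs → Maybe ℕ
run zero    p pc r = nothing
run (suc k) p pc r with fetch p pc
... | nothing        = just (r 0)
... | just (inc i)   = run k p (suc pc) (update r i (suc (r i)))
... | just (dec i j) with r i
...   | zero  = run k p j r
...   | suc v = run k p (suc pc) (update r i v)

initRegs : ℕ → Regs
initRegs x = update (λ _ → 0) 0 x

_·_↦_ : ℕ → ℕ → ℕ → Set
e · x ↦ v = ∃[ k ] (run k (prog e) 0 (initRegs x) ≡ just v)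

-- κ(x) = φ_x(x);  KIter i x z  means  κ^i(x) ↓= z

KIter : ℕ → ℕ → ℕ → Set
KIter zero    x z = x ≡ z
KIter (suc i) x z = ∃[ y ] (KIter i x y × (y · y ↦ z))

ωω : Rel ℕ 0ℓ
ωω x y = ∃[ i ] ∃[ z ] (KIter i x z × KIter i y z)

-- R ⊆ ℕ² is c.e.: it is (the image under the pairing bijection of)
-- the domain of some φ_e
IsCE₂ : Rel ℕ 0ℓ → Set
IsCE₂ R = ∃[ e ] (∀ x y → R x y ⇔ (∃[ n ] (unpair n ≡ (x , y) × ∃[ v ] (e · n ↦ v))))

record IsCeer (R : Rel ℕ 0ℓ) : Set where
  field
    isEquivalence : IsEquivalence R
    isCE          : IsCE₂ R

IsComputable : (ℕ → ℕ) → Set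
IsComputable f = ∃[ e ] (∀ x → e · x ↦ f x)

_≤c_ : Rel ℕ 0ℓ → Rel ℕ 0ℓ → Set
R ≤c S = ∃[ f ] (IsComputable f × (∀ x y → R x y ⇔ S (f x) (f y)))

module Submission where

-- Let R be a ceer, enumerated by E = φₑ: R x y iff E halts on pair x y.
-- For a budget s let candidate s x be the least w < x such that E halts on
-- pair x w within s steps, or x if there is none; then candidate s x ≤ x and
-- R x (candidate s x).  We write register-machine programs ⟨x , s⟩ with
-- κ ⟨x , s⟩ = ⟨candidate s x , s + 1⟩: as κ runs a program on its own code,
-- a node program reads x, s and the code of its main block from its input.
-- So κⁱ ⟨x , 0⟩ = ⟨orbit i x , i⟩ with orbit i x R-equivalent to x, and the
-- orbits of R-equivalent a > b meet: once the budget covers the halting time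
-- of E on pair a b, the orbit of a drops below a (induction on a + b).
-- Hence x ↦ ⟨x , 0⟩ reduces R to ω^(ω).

open import Defs
open import Level using (0ℓ)
open import Data.Nat
open import Data.Nat.Properties
open import Data.Bool using (true; false; T; not; if_then_else_)
open import Data.List using (List; []; _∷_; map; _++_; length; replicate)
open import Data.List.Properties using (length-++; length-map; ++-identityʳ)
open import Data.Maybe using (Maybe; just; nothing)
open import Data.Product using (Σ; ∃; ∃-syntax; _×_; _,_; proj₁; proj₂)
open import Data.Sum using (_⊎_; inj₁; inj₂)
open import Data.Empty using (⊥-elim)
open import Relation.Binary using (Rel; IsEquivalence; tri<; tri≈; tri>)
open import Relation.Binary.PropositionalEquality
open import Relation.Nullary using (yes; no)
open import Function.Bundles using (_⇔_; mk⇔; Equivalence)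


update-hit : ∀ (r : Regs) i v → update r i v i ≡ v
update-hit r i v with i ≡ᵇ i in eq
... | true  = refl
... | false = ⊥-elim (subst T eq (≡⇒≡ᵇ i i refl))

update-miss : ∀ (r : Regs) i v {j} → j ≢ i → update r i v j ≡ r j
update-miss r i v {j} j≢i with j ≡ᵇ i in eq
... | true  = ⊥-elim (j≢i (≡ᵇ⇒≡ j i (subst T (sym eq) _)))
... | false = refl

update-cong : ∀ {r s : Regs} → r ≗ s → ∀ i v → update r i v ≗ update s i v
update-cong r≗s i v j with j ≡ᵇ i
... | true  = refl
... | false = r≗s j

run-cong : ∀ k p pc {r s} → r ≗ s → run k p pc r ≡ run k p pc s
run-cong zero    p pc r≗s = refl
run-cong (suc k) p pc {r} {s} r≗s with fetch p pc
... | nothing = cong just (r≗s 0)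
... | just (inc i) rewrite r≗s i = run-cong k p (suc pc) (update-cong r≗s i (suc (s i)))
... | just (dec i j) with r i | s i | r≗s i
...   | zero  | .zero  | refl = run-cong k p j r≗s
...   | suc v | .suc v | refl = run-cong k p (suc pc) (update-cong r≗s i v)

run-mono : ∀ k p pc r {v} → run k p pc r ≡ just v → run (suc k) p pc r ≡ just v
run-mono zero    p pc r ()
run-mono (suc k) p pc r eq with fetch p pc
... | nothing      = eq
... | just (inc i) = run-mono k p (suc pc) _ eq
... | just (dec i j) with r i
...   | zero  = run-mono k p j r eq
...   | suc w = run-mono k p (suc pc) _ eq

run-mono-+ : ∀ j k p pc r {v} → run k p pc r ≡ just v → run (j + k) p pc r ≡ just v
run-mono-+ zero    k p pc r eq = eq
run-mono-+ (suc j) k p pc r eq = run-mono (j + k) p pc r (run-mono-+ j k p pc r eq)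

run-mono-≤ : ∀ {k k'} p pc r {v} → k ≤ k' → run k p pc r ≡ just v → run k' p pc r ≡ just v
run-mono-≤ {k} {k'} p pc r k≤k' eq =
  subst (λ t → run t p pc r ≡ just _) (m∸n+n≡m k≤k') (run-mono-+ (k' ∸ k) k p pc r eq)

just-injective : ∀ {a b : ℕ} → just a ≡ just b → a ≡ b
just-injective refl = refl

↦-functional : ∀ {e x v w} → e · x ↦ v → e · x ↦ w → v ≡ w
↦-functional {e} {x} (k , hv) (k' , hw) with ≤-total k k'
... | inj₁ k≤k' = just-injective (trans (sym (run-mono-≤ (prog e) 0 (initRegs x) k≤k' hv)) hw)
... | inj₂ k'≤k = just-injective (trans (sym hv) (run-mono-≤ (prog e) 0 (initRegs x) k'≤k hw))

-- Reach p pc r pc' r' : the machine p, started at program counter pc with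
-- registers r, arrives after finitely many steps at pc' with registers r'.
Reach : Prog → ℕ → Regs → ℕ → Regs → Set
Reach p pc r pc' r' = Σ ℕ λ n → ∀ k → run (n + k) p pc r ≡ run k p pc' r'

reach-refl : ∀ {p pc r} → Reach p pc r pc r
reach-refl = 0 , λ k → refl

infixr 5 _⨾_
_⨾_ : ∀ {p pc r pc' r' pc'' r''} → Reach p pc r pc' r' → Reach p pc' r' pc'' r'' → Reach p pc r pc'' r''
_⨾_ {p} {pc} {r} (n , f) (m , g) =
  n + m , λ k → trans (cong (λ t → run t p pc r) (+-assoc n m k)) (trans (f (m + k)) (g k))

reach-≗ : ∀ {p pc r pc' r₁ r₂} → Reach p pc r pc' r₁ → r₁ ≗ r₂ → Reach p pc r pc' r₂
reach-≗ {p} {pc' = pc'} (n , f) r₁≗r₂ = n , λ k → trans (f k) (run-cong k p pc' r₁≗r₂)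

≗-reach : ∀ {p pc r₁ r₂ pc' r'} → r₁ ≗ r₂ → Reach p pc r₂ pc' r' → Reach p pc r₁ pc' r'
≗-reach {p} {pc} r₁≗r₂ (n , f) = n , λ k → trans (run-cong (n + k) p pc r₁≗r₂) (f k)

reach-at : ∀ {p pc r pc₁ pc₂ r'} → pc₁ ≡ pc₂ → Reach p pc r pc₁ r' → Reach p pc r pc₂ r'
reach-at refl reach = reach

inc-step : ∀ {p pc r i} → fetch p pc ≡ just (inc i) → Reach p pc r (suc pc) (update r i (suc (r i)))
inc-step {p} {pc} fetched = 1 , λ k → go fetched
  where
  go : ∀ {r i k} → fetch p pc ≡ just (inc i) → run (suc k) p pc r ≡ run k p (suc pc) (update r i (suc (r i)))
  go fetched with fetch p pc
  go refl | .(just _) = refl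

dec-zero-step : ∀ {p pc r i j} → fetch p pc ≡ just (dec i j) → r i ≡ 0 → Reach p pc r j r
dec-zero-step {p} {pc} fetched z = 1 , λ k → go fetched z
  where
  go : ∀ {r i j k} → fetch p pc ≡ just (dec i j) → r i ≡ 0 → run (suc k) p pc r ≡ run k p j r
  go {r} {i} fetched z with fetch p pc
  go {r} {i} refl z | .(just _) with r i
  go {r} {i} refl refl | .(just _) | .0 = refl

dec-suc-step : ∀ {p pc r i j v} → fetch p pc ≡ just (dec i j) → r i ≡ suc v → Reach p pc r (suc pc) (update r i v)
dec-suc-step {p} {pc} fetched s = 1 , λ k → go fetched s
  where
  go : ∀ {r i j v k} → fetch p pc ≡ just (dec i j) → r i ≡ suc v → run (suc k) p pc r ≡ run k p (suc pc) (update r i v)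
  go {r} {i} fetched s with fetch p pc
  go {r} {i} refl s | .(just _) with r i
  go {r} {i} refl refl | .(just _) | .(suc _) = refl

reach-halt : ∀ {p pc r pc' r'} → Reach p pc r pc' r' → fetch p pc' ≡ nothing → ∃[ k ] (run k p pc r ≡ just (r' 0))
reach-halt {p} {pc' = pc'} (n , f) outside = n + 1 , trans (f 1) (halt outside)
  where
  halt : ∀ {r'} → fetch p pc' ≡ nothing → run 1 p pc' r' ≡ just (r' 0)
  halt outside with fetch p pc'
  halt refl | .nothing = refl

fetch-beyond : ∀ (p : Prog) {j} → length p ≤ j → fetch p j ≡ nothing
fetch-beyond []      le        = refl
fetch-beyond (x ∷ p) (s≤s le) = fetch-beyond p le


-- Programs are assembled from blocks.  A block is written with jump targets
-- relative to its own start; placing it at offset o shifts them by o.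
reloc : ℕ → Instr → Instr
reloc o (inc i)   = inc i
reloc o (dec i j) = dec i (j + o)

Contains : Prog → ℕ → Prog → Set
Contains p o B = ∀ i ins → fetch B i ≡ just ins → fetch p (i + o) ≡ just (reloc o ins)

infixr 5 _⊕_
_⊕_ : Prog → Prog → Prog
A ⊕ B = A ++ map (reloc (length A)) B

length-⊕ : ∀ A B → length (A ⊕ B) ≡ length A + length B
length-⊕ A B = trans (length-++ A) (cong (length A +_) (length-map (reloc (length A)) B))

fetch-++ˡ : ∀ A B {i ins} → fetch A i ≡ just ins → fetch (A ++ B) i ≡ just ins
fetch-++ˡ (x ∷ A) B {zero}  e = e
fetch-++ˡ (x ∷ A) B {suc i} e = fetch-++ˡ A B e

fetch-++ʳ : ∀ A B i → fetch (A ++ B) (length A + i) ≡ fetch B i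
fetch-++ʳ []      B i = refl
fetch-++ʳ (x ∷ A) B i = fetch-++ʳ A B i

fetch-map : ∀ f B {i ins} → fetch B i ≡ just ins → fetch (map f B) i ≡ just (f ins)
fetch-map f (x ∷ B) {zero}  refl = refl
fetch-map f (x ∷ B) {suc i} e    = fetch-map f B e

reloc-reloc : ∀ o m ins → reloc o (reloc m ins) ≡ reloc (m + o) ins
reloc-reloc o m (inc i)   = refl
reloc-reloc o m (dec i j) = cong (dec i) (+-assoc j m o)

contains-++ˡ : ∀ {p o} A B → Contains p o (A ++ B) → Contains p o A
contains-++ˡ A B c i ins e = c i ins (fetch-++ˡ A B e)

contains-⊕ˡ : ∀ {p o} A B → Contains p o (A ⊕ B) → Contains p o A
contains-⊕ˡ {p} {o} A B = contains-++ˡ {p} {o} A (map (reloc (length A)) B)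

contains-middle : ∀ {p o} A B C → Contains p o (A ++ map (reloc (length A)) B ++ C) → Contains p (length A + o) B
contains-middle {p} {o} A B C c i ins e =
  trans (cong (fetch p) (trans (sym (+-assoc i (length A) o)) (cong (_+ o) (+-comm i (length A)))))
        (trans (c (length A + i) (reloc (length A) ins)
                  (trans (fetch-++ʳ A _ i) (fetch-++ˡ (map (reloc (length A)) B) C (fetch-map (reloc (length A)) B e))))
               (cong just (reloc-reloc o (length A) ins)))

contains-⊕ʳ : ∀ {p o} A B → Contains p o (A ⊕ B) → Contains p (length A + o) B
contains-⊕ʳ {p} {o} A B c =
  contains-middle {p} {o} A B [] (subst (Contains p o) (cong (A ++_) (sym (++-identityʳ (map (reloc (length A)) B)))) c)

-- A block tree records how a straight-line program is assembled from
-- blocks, so that the behaviour of the whole follows from that of its parts.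
infixr 4 _▸_
data Block : Set where
  ▪   : Prog → Block
  _▸_ : Block → Block → Block

flat : Block → Prog
flat (▪ P)   = P
flat (A ▸ B) = flat A ⊕ flat B

record Runs (B : Block) (R R' : Regs) : Set where
  constructor runs
  field run-block : ∀ {p o} → Contains p o (flat B) → Reach p o R (length (flat B) + o) R'
open Runs public

sequence : ∀ {p o R R₁ R₂} A B → Contains p o (flat (A ▸ B)) →
           (Contains p o (flat A) → Reach p o R (length (flat A) + o) R₁) →
           (Contains p (length (flat A) + o) (flat B) → Reach p (length (flat A) + o) R₁ (length (flat B) + (length (flat A) + o)) R₂) →
           Reach p o R (length (flat (A ▸ B)) + o) R₂
sequence {p} {o} A B c first second =
  reach-at exit (first (contains-⊕ˡ {p} {o} (flat A) (flat B) c) ⨾ second (contains-⊕ʳ {p} {o} (flat A) (flat B) c))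
  where
  exit : length (flat B) + (length (flat A) + o) ≡ length (flat A ⊕ flat B) + o
  exit = trans (sym (+-assoc (length (flat B)) _ o))
               (cong (_+ o) (trans (+-comm (length (flat B)) _) (sym (length-⊕ (flat A) (flat B)))))

infixr 3 _⟫_
_⟫_ : ∀ {A B R R₁ R₂} → Runs A R R₁ → Runs B R₁ R₂ → Runs (A ▸ B) R R₂
_⟫_ {A} {B} (runs first) (runs second) = runs λ c → sequence A B c first second

runs-≗ : ∀ {B R R₁ R₂} → Runs B R R₁ → R₁ ≗ R₂ → Runs B R R₂
runs-≗ (runs f) R₁≗R₂ = runs λ c → reach-≗ (f c) R₁≗R₂


-- Gödel numbering.  The inverse of the Cantor enumeration `unpair`:
-- pair a b = tri (a + b) + a, where tri d = 1 + 2 + … + d.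
tri : ℕ → ℕ
tri zero    = 0
tri (suc d) = suc d + tri d

pair : ℕ → ℕ → ℕ
pair a b = tri (a + b) + a

unpair-diagonal : ∀ d a → a ≤ d → unpair (tri d + a) ≡ (a , d ∸ a)
unpair-diagonal zero    zero    z≤n = refl
unpair-diagonal (suc d) zero    z≤n =
  trans (cong (λ t → next (unpair t)) (trans (+-identityʳ (d + tri d)) (+-comm d (tri d))))
        (cong next (trans (unpair-diagonal d d ≤-refl) (cong (d ,_) (n∸n≡0 d))))
unpair-diagonal d (suc a) a<d
  rewrite +-suc (tri d) a | unpair-diagonal d a (<⇒≤ a<d) | +-∸-assoc 1 a<d = refl

unpair-pair : ∀ a b → unpair (pair a b) ≡ (a , b)
unpair-pair a b rewrite unpair-diagonal (a + b) a (m≤m+n a b) | m+n∸m≡n a b = refl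

pair-next : ∀ a b → pair (proj₁ (next (a , b))) (proj₂ (next (a , b))) ≡ suc (pair a b)
pair-next a zero    rewrite +-identityʳ a = cong suc (trans (+-identityʳ (a + tri a)) (+-comm a (tri a)))
pair-next a (suc b) rewrite +-suc a b | +-suc (tri (suc (a + b))) a = refl

pair-unpair : ∀ n → pair (proj₁ (unpair n)) (proj₂ (unpair n)) ≡ n
pair-unpair zero    = refl
pair-unpair (suc n) = trans (pair-next (proj₁ (unpair n)) (proj₂ (unpair n))) (cong suc (pair-unpair n))

unpair-injective : ∀ {m n} → unpair m ≡ unpair n → m ≡ n
unpair-injective {m} {n} e =
  trans (sym (pair-unpair m)) (trans (cong (λ u → pair (proj₁ u) (proj₂ u)) e) (pair-unpair n))

encI : Instr → ℕ
encI (inc i)   = pair 0 i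
encI (dec i j) = pair 1 (pair i j)

encWith : Prog → ℕ → ℕ
encWith []       rest = rest
encWith (x ∷ xs) rest = suc (pair (encI x) (encWith xs rest))

enc : Prog → ℕ
enc p = encWith p 0

enc-++ : ∀ A B → enc (A ++ B) ≡ encWith A (enc B)
enc-++ []      B = refl
enc-++ (x ∷ A) B = cong (λ t → suc (pair (encI x) t)) (enc-++ A B)

decodeInstr-encI : ∀ i → decodeInstr (encI i) ≡ i
decodeInstr-encI (inc i)   rewrite unpair-pair 0 i = refl
decodeInstr-encI (dec i j) rewrite unpair-pair 1 (pair i j) | unpair-pair i j = refl

tri-≥ : ∀ d → d ≤ tri d
tri-≥ zero    = z≤n
tri-≥ (suc d) = m≤m+n (suc d) (tri d)

pair-≥ʳ : ∀ a b → b ≤ pair a b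
pair-≥ʳ a b = ≤-trans (m≤n+m b a) (≤-trans (tri-≥ (a + b)) (m≤m+n (tri (a + b)) a))

-- decodeList needs fuel at least the code itself
decodeListF-enc : ∀ p fuel → enc p ≤ fuel → decodeListF fuel (enc p) ≡ map encI p
decodeListF-enc []      zero       le       = refl
decodeListF-enc []      (suc fuel) le       = refl
decodeListF-enc (x ∷ p) (suc fuel) (s≤s le) rewrite unpair-pair (encI x) (enc p) =
  cong (encI x ∷_) (decodeListF-enc p fuel (≤-trans (pair-≥ʳ (encI x) (enc p)) le))

prog-enc : ∀ p → prog (enc p) ≡ p
prog-enc p = trans (cong (map decodeInstr) (decodeListF-enc p (enc p) ≤-refl)) (decode-all p)
  where
  decode-all : ∀ p → map decodeInstr (map encI p) ≡ p
  decode-all []      = refl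
  decode-all (x ∷ p) = cong₂ _∷_ (decodeInstr-encI x) (decode-all p)


-- Convention: register 1 always holds 0, so `dec 1 j` is an unconditional
-- jump to j.

hits : ℕ → List ℕ → ℕ
hits j []       = 0
hits j (d ∷ ds) = (if j ≡ᵇ d then 1 else 0) + hits j ds

bumps : List ℕ → ℕ → Regs → Regs
bumps []       k R = R
bumps (d ∷ ds) k R = bumps ds k (update R d (R d + k))

bumps-at : ∀ ds k R j → bumps ds k R j ≡ R j + hits j ds * k
bumps-at []       k R j = sym (+-identityʳ (R j))
bumps-at (d ∷ ds) k R j rewrite bumps-at ds k (update R d (R d + k)) j with j ≡ᵇ d in eq
... | true  rewrite ≡ᵇ⇒≡ j d (subst T (sym eq) _) = +-assoc (R d) k (hits d ds * k)
... | false = refl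

-- A sequence of increments contains no jumps, so it may be shifted freely.
incs-no-jump : ∀ ds {i ins o o'} → fetch (map inc ds) i ≡ just ins → reloc o ins ≡ reloc o' ins
incs-no-jump (d ∷ ds) {zero}  refl = refl
incs-no-jump (d ∷ ds) {suc i} e    = incs-no-jump ds e

incs-reach : ∀ {p o} ds R → Contains p o (map inc ds) → Reach p o R (length ds + o) (bumps ds 1 R)
incs-reach         []       R c = reach-refl
incs-reach {p} {o} (d ∷ ds) R c =
  inc-step (c 0 _ refl) ⨾
  reach-at (+-suc (length ds) o)
    (reach-≗ (incs-reach ds _ shifted) λ j → trans (bumps-at ds 1 _ j)
                                          (trans (cong (_+ hits j ds * 1) (update-suc j))
                                                 (sym (bumps-at ds 1 (update R d (R d + 1)) j))))
  where
  shifted : Contains p (suc o) (map inc ds)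
  shifted i ins e = trans (cong (fetch p) (+-suc i o)) (trans (c (suc i) ins e) (cong just (incs-no-jump ds e)))
  update-suc : ∀ j → update R d (suc (R d)) j ≡ update R d (R d + 1) j
  update-suc j with j ≡ᵇ d
  ... | true  = sym (+-comm (R d) 1)
  ... | false = refl

hits-skip : ∀ {j d} ds → j ≢ d → hits j (d ∷ ds) ≡ hits j ds
hits-skip {j} {d} ds j≢d with j ≡ᵇ d in eq
... | true  = ⊥-elim (j≢d (≡ᵇ⇒≡ j d (subst T (sym eq) _)))
... | false = refl

hits-here : ∀ j ds → hits j (j ∷ ds) ≡ suc (hits j ds)
hits-here j ds with j ≡ᵇ j in eq
... | true  = refl
... | false = ⊥-elim (subst T eq (≡⇒≡ᵇ j j refl))

-- The transfer loop: while R s ≠ 0, decrement R s and increment every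
-- register listed in ds.  Moving, clearing and copying are instances.
transferB : ℕ → List ℕ → Prog
transferB s ds = dec s (2 + length ds) ∷ (map inc ds ++ dec 1 0 ∷ [])

length-transferB : ∀ s ds → length (transferB s ds) ≡ 2 + length ds
length-transferB s ds = cong suc (trans (length-++ (map inc ds)) (trans (cong (_+ 1) (length-map inc ds)) (+-comm (length ds) 1)))

loop-back : ∀ ds → fetch (map inc ds ++ dec 1 0 ∷ []) (length ds) ≡ just (dec 1 0)
loop-back []       = refl
loop-back (d ∷ ds) = loop-back ds

transfer : ℕ → List ℕ → Regs → Regs
transfer s ds R = update (bumps ds (R s) R) s 0

transfer-at : ∀ s ds R {j} → j ≢ s → transfer s ds R j ≡ R j + hits j ds * R s
transfer-at s ds R j≢s = trans (update-miss (bumps ds (R s) R) s 0 j≢s) (bumps-at ds (R s) R _)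

transfer-idle : ∀ s ds R → R s ≡ 0 → R ≗ transfer s ds R
transfer-idle s ds R e j with j ≟ s
... | yes refl = trans e (sym (update-hit (bumps ds (R s) R) s 0))
... | no j≢s   = sym (trans (transfer-at s ds R j≢s)
                            (trans (cong (λ v → R j + hits j ds * v) e)
                                   (trans (cong (R j +_) (*-zeroʳ (hits j ds))) (+-identityʳ (R j)))))

round : ℕ → List ℕ → Regs → ℕ → Regs
round s ds R v = bumps ds 1 (update R s v)

round-at-s : ∀ s ds R v → hits s ds ≡ 0 → round s ds R v s ≡ v
round-at-s s ds R v s∉ds =
  trans (bumps-at ds 1 (update R s v) s) (trans (cong₂ (λ a h → a + h * 1) (update-hit R s v) s∉ds) (+-identityʳ v))

round-at-1 : ∀ s ds R v → s ≢ 1 → hits 1 ds ≡ 0 → R 1 ≡ 0 → round s ds R v 1 ≡ 0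
round-at-1 s ds R v s≢1 1∉ds z =
  trans (bumps-at ds 1 (update R s v) 1) (cong₂ (λ a h → a + h * 1) (trans (update-miss R s v (≢-sym s≢1)) z) 1∉ds)

transfer-round : ∀ s ds R v → hits s ds ≡ 0 → R s ≡ suc v → transfer s ds (round s ds R v) ≗ transfer s ds R
transfer-round s ds R v s∉ds e j with j ≟ s
... | yes refl = trans (update-hit (bumps ds (R′ s) R′) s 0) (sym (update-hit (bumps ds (R s) R) s 0))
  where R′ : Regs
        R′ = round s ds R v
... | no j≢s   = begin
  transfer s ds (round s ds R v) j            ≡⟨ transfer-at s ds _ j≢s ⟩
  round s ds R v j + h * round s ds R v s     ≡⟨ cong₂ (λ a b → a + h * b) (bumps-at ds 1 (update R s v) j) (round-at-s s ds R v s∉ds) ⟩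
  (update R s v j + h * 1) + h * v            ≡⟨ cong (λ a → a + h * 1 + h * v) (update-miss R s v j≢s) ⟩
  (R j + h * 1) + h * v                       ≡⟨ +-assoc (R j) (h * 1) (h * v) ⟩
  R j + (h * 1 + h * v)                       ≡⟨ cong (R j +_) (sym (*-distribˡ-+ h 1 v)) ⟩
  R j + h * suc v                             ≡⟨ cong (λ b → R j + h * b) (sym e) ⟩
  R j + h * R s                               ≡⟨ sym (transfer-at s ds R j≢s) ⟩
  transfer s ds R j                           ∎
  where open ≡-Reasoning
        h : ℕ
        h = hits j ds

-- The loop runs by induction on R s; register 1 must stay zero for the jump back.
transfer-runs : ∀ s ds → s ≢ 1 → hits s ds ≡ 0 → hits 1 ds ≡ 0 →
                ∀ R → R 1 ≡ 0 → Runs (▪ (transferB s ds)) R (transfer s ds R)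
transfer-runs s ds s≢1 s∉ds 1∉ds R z = runs (loop (R s) R refl z)
  where
  loop : ∀ {p o} v R → R s ≡ v → R 1 ≡ 0 → Contains p o (transferB s ds) →
         Reach p o R (length (transferB s ds) + o) (transfer s ds R)
  loop {o = o} zero R e z c =
    reach-at (cong (_+ o) (sym (length-transferB s ds))) (reach-≗ (dec-zero-step (c 0 _ refl) e) (transfer-idle s ds R e))
  loop {p} {o} (suc v) R e z c =
    dec-suc-step (c 0 _ refl) e ⨾
    incs-reach ds _ incs-inside ⨾
    dec-zero-step (subst (λ pc → fetch p pc ≡ just (dec 1 o)) (sym (+-suc (length ds) o)) (c (suc (length ds)) _ (loop-back ds)))
                  (round-at-1 s ds R v s≢1 1∉ds z) ⨾
    reach-≗ (loop v (round s ds R v) (round-at-s s ds R v s∉ds) (round-at-1 s ds R v s≢1 1∉ds z) c) (transfer-round s ds R v s∉ds e)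
    where
    incs-inside : Contains p (suc o) (map inc ds)
    incs-inside i ins e' = trans (cong (fetch p) (+-suc i o))
                                 (trans (c (suc i) ins (fetch-++ˡ (map inc ds) _ e')) (cong just (incs-no-jump ds e')))

moveB : ℕ → ℕ → Prog
moveB s d = transferB s (d ∷ [])

move-runs : ∀ s d → s ≢ d → s ≢ 1 → d ≢ 1 → ∀ R → R 1 ≡ 0 →
            Runs (▪ (moveB s d)) R (update (update R d (R d + R s)) s 0)
move-runs s d s≢d s≢1 d≢1 = transfer-runs s (d ∷ []) s≢1 (hits-skip [] s≢d) (hits-skip [] (≢-sym d≢1))

clearB : ℕ → Prog
clearB d = transferB d []

clear-runs : ∀ d → d ≢ 1 → ∀ R → R 1 ≡ 0 → Runs (▪ (clearB d)) R (update R d 0)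
clear-runs d d≢1 = transfer-runs d [] d≢1 refl refl

-- Copying through a temporary register t: move s to both d and t, then
-- move t back to s.  Only d changes.
copyT : ℕ → ℕ → ℕ → Block
copyT s d t = ▪ (transferB s (d ∷ t ∷ [])) ▸ ▪ (moveB t s)

copy-restores : ∀ s d t R → s ≢ d → s ≢ t → d ≢ t → R t ≡ 0 →
                transfer t (s ∷ []) (transfer s (d ∷ t ∷ []) R) ≗ update R d (R d + R s)
copy-restores s d t R s≢d s≢t d≢t t≡0 = restored
  where
  R₁ R₂ : Regs
  R₁ = transfer s (d ∷ t ∷ []) R
  R₂ = update R₁ s (R₁ s + R₁ t)

  R₁-t : R₁ t ≡ R s
  R₁-t = trans (transfer-at s (d ∷ t ∷ []) R (≢-sym s≢t))
               (trans (cong₂ (λ a h → a + h * R s) t≡0 (trans (hits-skip (t ∷ []) (≢-sym d≢t)) (hits-here t [])))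
                      (+-identityʳ (R s)))

  moved-to-d : ∀ {j} → j ≢ t → R j + hits j (d ∷ t ∷ []) * R s ≡ update R d (R d + R s) j
  moved-to-d {j} j≢t with j ≟ d
  ... | yes refl = trans (cong (λ h → R j + h * R s) (trans (hits-here j (t ∷ [])) (cong suc (hits-skip [] j≢t))))
                         (trans (cong (R j +_) (+-identityʳ (R s))) (sym (update-hit R j _)))
  ... | no j≢d   = trans (cong (λ h → R j + h * R s) (trans (hits-skip (t ∷ []) j≢d) (hits-skip [] j≢t)))
                         (trans (+-identityʳ (R j)) (sym (update-miss R d _ j≢d)))

  restored : update R₂ t 0 ≗ update R d (R d + R s)
  restored j with j ≟ t
  ... | yes refl = trans (update-hit R₂ j 0) (sym (trans (update-miss R d _ (≢-sym d≢t)) t≡0))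
  ... | no j≢t with j ≟ s
  ...   | yes refl = trans (update-miss R₂ t 0 j≢t)
                     (trans (update-hit R₁ j _)
                     (trans (cong₂ _+_ (update-hit (bumps (d ∷ t ∷ []) (R j) R) j 0) R₁-t)
                            (sym (update-miss R d _ s≢d))))
  ...   | no j≢s   = trans (update-miss R₂ t 0 j≢t)
                     (trans (update-miss R₁ s _ j≢s)
                     (trans (transfer-at s (d ∷ t ∷ []) R j≢s) (moved-to-d j≢t)))

copy-runs : ∀ s d t → s ≢ d → s ≢ t → d ≢ t → s ≢ 1 → d ≢ 1 → t ≢ 1 →
            ∀ R → R 1 ≡ 0 → R t ≡ 0 → Runs (copyT s d t) R (update R d (R d + R s))
copy-runs s d t s≢d s≢t d≢t s≢1 d≢1 t≢1 R z t≡0 =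
  runs-≗ (transfer-runs s (d ∷ t ∷ []) s≢1 (miss s≢d s≢t) (miss (≢-sym d≢1) (≢-sym t≢1)) R z
          ⟫ move-runs t s (≢-sym s≢t) t≢1 s≢1 _ still-zero)
         (copy-restores s d t R s≢d s≢t d≢t t≡0)
  where
  miss : ∀ {j} → j ≢ d → j ≢ t → hits j (d ∷ t ∷ []) ≡ 0
  miss j≢d j≢t = trans (hits-skip (t ∷ []) j≢d) (hits-skip [] j≢t)
  still-zero : transfer s (d ∷ t ∷ []) R 1 ≡ 0
  still-zero = trans (transfer-at s (d ∷ t ∷ []) R (≢-sym s≢1)) (cong₂ (λ a h → a + h * R s) z (miss (≢-sym d≢1) (≢-sym t≢1)))

loadB : ℕ → ℕ → Prog
loadB d c = map inc (replicate c d)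

load-runs : ∀ d c R → Runs (▪ (loadB d c)) R (update R d (R d + c))
load-runs d c R = runs λ {p} {o} contained →
  reach-at (cong (_+ o) (sym (length-map inc (replicate c d))))
           (reach-≗ (incs-reach (replicate c d) R contained) loaded)
  where
  loaded : bumps (replicate c d) 1 R ≗ update R d (R d + c)
  loaded j with j ≟ d
  ... | yes refl = trans (bumps-at (replicate c d) 1 R j) (trans (cong (R j +_) (trans (cong (_* 1) (hits-all c)) (*-identityʳ c)))
                                                   (sym (update-hit R j _)))
    where hits-all : ∀ c → hits j (replicate c j) ≡ c
          hits-all zero    = refl
          hits-all (suc c) = trans (hits-here j (replicate c j)) (cong suc (hits-all c))
  ... | no j≢d = trans (bumps-at (replicate c d) 1 R j) (trans (cong (λ h → R j + h * 1) (hits-none c)) (trans (+-identityʳ (R j))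
                                                   (sym (update-miss R d _ j≢d))))
    where hits-none : ∀ c → hits j (replicate c d) ≡ 0
          hits-none zero    = refl
          hits-none (suc c) = trans (hits-skip (replicate c d) j≢d) (hits-none c)

set3 : ℕ → ℕ → ℕ → Regs → ℕ → ℕ → ℕ → Regs
set3 a b c R x y z = update (update (update R a x) b y) c z

-- For three distinct registers, set3 behaves like a record of three
-- variables over the background R; each instruction acting on one of them
-- acts on the corresponding variable.
module Slots (a b c : ℕ) (a≢b : a ≢ b) (a≢c : a ≢ c) (b≢c : b ≢ c) (R : Regs) where

  S : ℕ → ℕ → ℕ → Regs
  S = set3 a b c R

  S-a : ∀ x y z → S x y z a ≡ x
  S-a x y z = trans (update-miss (update (update R a x) b y) c z a≢c)
                    (trans (update-miss (update R a x) b y a≢b) (update-hit R a x))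

  S-b : ∀ x y z → S x y z b ≡ y
  S-b x y z = trans (update-miss (update (update R a x) b y) c z b≢c) (update-hit (update R a x) b y)

  S-c : ∀ x y z → S x y z c ≡ z
  S-c x y z = update-hit (update (update R a x) b y) c z

  S-other : ∀ x y z {j} → j ≢ a → j ≢ b → j ≢ c → S x y z j ≡ R j
  S-other x y z j≢a j≢b j≢c =
    trans (update-miss (update (update R a x) b y) c z j≢c)
          (trans (update-miss (update R a x) b y j≢b) (update-miss R a x j≢a))

  agree : ∀ {F G : Regs} → F a ≡ G a → F b ≡ G b → F c ≡ G c →
          (∀ {j} → j ≢ a → j ≢ b → j ≢ c → F j ≡ G j) → F ≗ G
  agree ea eb ec eo j with j ≟ a | j ≟ b | j ≟ c
  ... | yes refl | _        | _        = ea
  ... | no _     | yes refl | _        = eb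
  ... | no _     | no _     | yes refl = ec
  ... | no j≢a   | no j≢b   | no j≢c   = eo j≢a j≢b j≢c

  self : R ≗ S (R a) (R b) (R c)
  self = agree (sym (S-a _ _ _)) (sym (S-b _ _ _)) (sym (S-c _ _ _)) (λ j≢a j≢b j≢c → sym (S-other _ _ _ j≢a j≢b j≢c))

  initial : R a ≡ 0 → R b ≡ 0 → ∀ z → R c ≡ z → R ≗ S 0 0 z
  initial ra rb z rc = agree (trans ra (sym (S-a 0 0 z))) (trans rb (sym (S-b 0 0 z))) (trans rc (sym (S-c 0 0 z)))
                             (λ j≢a j≢b j≢c → sym (S-other 0 0 z j≢a j≢b j≢c))

  set-a : ∀ x y z x' → update (S x y z) a x' ≗ S x' y z
  set-a x y z x' = agree (trans (update-hit (S x y z) a x') (sym (S-a x' y z)))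
                         (trans (update-miss (S x y z) a x' (≢-sym a≢b)) (trans (S-b x y z) (sym (S-b x' y z))))
                         (trans (update-miss (S x y z) a x' (≢-sym a≢c)) (trans (S-c x y z) (sym (S-c x' y z))))
                         (λ j≢a j≢b j≢c → trans (update-miss (S x y z) a x' j≢a)
                                            (trans (S-other x y z j≢a j≢b j≢c) (sym (S-other x' y z j≢a j≢b j≢c))))

  set-b : ∀ x y z y' → update (S x y z) b y' ≗ S x y' z
  set-b x y z y' = agree (trans (update-miss (S x y z) b y' a≢b) (trans (S-a x y z) (sym (S-a x y' z))))
                         (trans (update-hit (S x y z) b y') (sym (S-b x y' z)))
                         (trans (update-miss (S x y z) b y' (≢-sym b≢c)) (trans (S-c x y z) (sym (S-c x y' z))))
                         (λ j≢a j≢b j≢c → trans (update-miss (S x y z) b y' j≢b)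
                                            (trans (S-other x y z j≢a j≢b j≢c) (sym (S-other x y' z j≢a j≢b j≢c))))

  set-c : ∀ x y z z' → update (S x y z) c z' ≗ S x y z'
  set-c x y z z' = agree (trans (update-miss (S x y z) c z' a≢c) (trans (S-a x y z) (sym (S-a x y z'))))
                         (trans (update-miss (S x y z) c z' b≢c) (trans (S-b x y z) (sym (S-b x y z'))))
                         (trans (update-hit (S x y z) c z') (sym (S-c x y z')))
                         (λ j≢a j≢b j≢c → trans (update-miss (S x y z) c z' j≢c)
                                            (trans (S-other x y z j≢a j≢b j≢c) (sym (S-other x y z' j≢a j≢b j≢c))))

  moved-b-a : ∀ x y z → update (update (S x y z) a (S x y z a + S x y z b)) b 0 ≗ S (x + y) 0 z
  moved-b-a x y z j = trans (update-cong (set-a x y z _) b 0 j)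
                            (trans (set-b _ y z 0 j) (cong (λ v → S v 0 z j) (cong₂ _+_ (S-a x y z) (S-b x y z))))

  moved-a-b : ∀ x y z → update (update (S x y z) b (S x y z b + S x y z a)) a 0 ≗ S 0 (y + x) z
  moved-a-b x y z j = trans (update-cong (set-b x y z _) a 0 j)
                            (trans (set-a x _ z 0 j) (cong (λ v → S 0 v z j) (cong₂ _+_ (S-b x y z) (S-a x y z))))

  module _ {p : Prog} {pc : ℕ} where
    inc-a : ∀ {x y z} → fetch p pc ≡ just (inc a) → Reach p pc (S x y z) (suc pc) (S (suc x) y z)
    inc-a {x} {y} {z} f = reach-≗ (inc-step f) λ j → trans (cong (λ v → update (S x y z) a v j) (cong suc (S-a x y z))) (set-a x y z _ j)

    inc-b : ∀ {x y z} → fetch p pc ≡ just (inc b) → Reach p pc (S x y z) (suc pc) (S x (suc y) z)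
    inc-b {x} {y} {z} f = reach-≗ (inc-step f) λ j → trans (cong (λ v → update (S x y z) b v j) (cong suc (S-b x y z))) (set-b x y z _ j)

    inc-c : ∀ {x y z} → fetch p pc ≡ just (inc c) → Reach p pc (S x y z) (suc pc) (S x y (suc z))
    inc-c {x} {y} {z} f = reach-≗ (inc-step f) λ j → trans (cong (λ v → update (S x y z) c v j) (cong suc (S-c x y z))) (set-c x y z _ j)

    dec-a : ∀ {x y z t} → fetch p pc ≡ just (dec a t) → Reach p pc (S (suc x) y z) (suc pc) (S x y z)
    dec-a {x} {y} {z} f = reach-≗ (dec-suc-step f (S-a (suc x) y z)) (set-a (suc x) y z x)

    dec-b : ∀ {x y z t} → fetch p pc ≡ just (dec b t) → Reach p pc (S x (suc y) z) (suc pc) (S x y z)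
    dec-b {x} {y} {z} f = reach-≗ (dec-suc-step f (S-b x (suc y) z)) (set-b x (suc y) z y)

    dec-c : ∀ {x y z t} → fetch p pc ≡ just (dec c t) → Reach p pc (S x y (suc z)) (suc pc) (S x y z)
    dec-c {x} {y} {z} f = reach-≗ (dec-suc-step f (S-c x y (suc z))) (set-c x y (suc z) z)

    zero-a : ∀ {y z t} → fetch p pc ≡ just (dec a t) → Reach p pc (S 0 y z) t (S 0 y z)
    zero-a {y} {z} f = dec-zero-step f (S-a 0 y z)

    zero-b : ∀ {x z t} → fetch p pc ≡ just (dec b t) → Reach p pc (S x 0 z) t (S x 0 z)
    zero-b {x} {z} f = dec-zero-step f (S-b x 0 z)

    zero-c : ∀ {x y t} → fetch p pc ≡ just (dec c t) → Reach p pc (S x y 0) t (S x y 0)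
    zero-c {x} {y} f = dec-zero-step f (S-c x y 0)

    jump : ∀ {x y z t} → R 1 ≡ 0 → a ≢ 1 → b ≢ 1 → c ≢ 1 → fetch p pc ≡ just (dec 1 t) → Reach p pc (S x y z) t (S x y z)
    jump {x} {y} {z} z1 a≢1 b≢1 c≢1 f = dec-zero-step f (trans (S-other x y z (≢-sym a≢1) (≢-sym b≢1) (≢-sym c≢1)) z1)

-- Pairing: add pair (R a) (R b) to R n and clear a and b.  The loop walks
-- the Cantor enumeration back from (R a , R b) to (0 , 0), counting steps in n.
pairB : ℕ → ℕ → ℕ → Prog
pairB a b n = (dec a 4 ∷ inc b ∷ inc n ∷ dec 1 0 ∷ dec b 10 ∷ []) ++ map (reloc 5) (moveB b a) ++ (inc n ∷ dec 1 0 ∷ [])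

pair-runs : ∀ a b n → a ≢ b → a ≢ n → b ≢ n → a ≢ 1 → b ≢ 1 → n ≢ 1 →
            ∀ R → R 1 ≡ 0 → Runs (▪ (pairB a b n)) R (set3 a b n R 0 0 (R n + pair (R a) (R b)))
pair-runs a b n a≢b a≢n b≢n a≢1 b≢1 n≢1 R z1 =
  runs λ c → ≗-reach self (loop c (pair (R a) (R b)) (unpair-pair (R a) (R b)) (R n))
  where
  open Slots a b n a≢b a≢n b≢n R
  loop : ∀ {p o} → Contains p o (pairB a b n) → ∀ m {x y} → unpair m ≡ (x , y) → ∀ z →
         Reach p o (S x y z) (10 + o) (S 0 0 (z + m))
  loop c zero    refl z = zero-a (c 0 _ refl) ⨾ reach-≗ (zero-b (c 4 _ refl)) (λ j → cong (λ w → S 0 0 w j) (sym (+-identityʳ z)))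
  loop c (suc m) e    z with unpair m in em
  loop {p} {o} c (suc m) refl z | u , zero  =
    zero-a (c 0 _ refl) ⨾ dec-b (c 4 _ refl) ⨾
    reach-≗ (run-block (move-runs b a (≢-sym a≢b) b≢1 a≢1 (S 0 u z) (trans (S-other 0 u z (≢-sym a≢1) (≢-sym b≢1) (≢-sym n≢1)) z1))
                       (contains-middle {p} {o} (dec a 4 ∷ inc b ∷ inc n ∷ dec 1 0 ∷ dec b 10 ∷ []) (moveB b a) _ c))
            (moved-b-a 0 u z) ⨾
    inc-c (c 8 _ refl) ⨾ jump z1 a≢1 b≢1 n≢1 (c 9 _ refl) ⨾
    reach-≗ (loop c m em (suc z)) (λ j → cong (λ w → S 0 0 w j) (sym (+-suc z m)))
  loop c (suc m) refl z | u , suc w =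
    dec-a (c 0 _ refl) ⨾ inc-b (c 1 _ refl) ⨾ inc-c (c 2 _ refl) ⨾ jump z1 a≢1 b≢1 n≢1 (c 3 _ refl) ⨾
    reach-≗ (loop c m em (suc z)) (λ j → cong (λ w → S 0 0 w j) (sym (+-suc z m)))

-- Unpairing: if R a = R b = 0, set (R a , R b) := unpair (R n) and clear n.
-- The loop steps the Cantor enumeration forward R n times.
unpairB : ℕ → ℕ → ℕ → Prog
unpairB n a b = (dec n 9 ∷ dec b 4 ∷ inc a ∷ dec 1 0 ∷ []) ++ map (reloc 4) (moveB a b) ++ (inc b ∷ dec 1 0 ∷ [])

unpair-runs : ∀ n a b → a ≢ b → a ≢ n → b ≢ n → a ≢ 1 → b ≢ 1 → n ≢ 1 →
              ∀ R → R 1 ≡ 0 → R a ≡ 0 → R b ≡ 0 →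
              Runs (▪ (unpairB n a b)) R (set3 a b n R (proj₁ (unpair (R n))) (proj₂ (unpair (R n))) 0)
unpair-runs n a b a≢b a≢n b≢n a≢1 b≢1 n≢1 R z1 ra rb =
  runs λ c → ≗-reach (initial ra rb (R n) refl)
               (reach-≗ (loop c (R n) 0 refl) (λ j → cong (λ m → S (proj₁ (unpair m)) (proj₂ (unpair m)) 0 j) (+-identityʳ (R n))))
  where
  open Slots a b n a≢b a≢n b≢n R
  loop : ∀ {p o} → Contains p o (unpairB n a b) → ∀ i k {x y} → unpair k ≡ (x , y) →
         Reach p o (S x y i) (9 + o) (S (proj₁ (unpair (i + k))) (proj₂ (unpair (i + k))) 0)
  loop c zero    k e = reach-≗ (zero-c (c 0 _ refl)) (λ j → cong (λ u → S (proj₁ u) (proj₂ u) 0 j) (sym e))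
  loop {p} {o} c (suc i) k {x} {zero}  e =
    dec-c (c 0 _ refl) ⨾ zero-b (c 1 _ refl) ⨾
    reach-≗ (run-block (move-runs a b a≢b a≢1 b≢1 (S x 0 i) (trans (S-other x 0 i (≢-sym a≢1) (≢-sym b≢1) (≢-sym n≢1)) z1))
                       (contains-middle {p} {o} (dec n 9 ∷ dec b 4 ∷ inc a ∷ dec 1 0 ∷ []) (moveB a b) _ c))
            (moved-a-b x 0 i) ⨾
    inc-b (c 7 _ refl) ⨾ jump z1 a≢1 b≢1 n≢1 (c 8 _ refl) ⨾
    reach-≗ (loop c i (suc k) (cong next e)) (λ j → cong (λ m → S (proj₁ (unpair m)) (proj₂ (unpair m)) 0 j) (+-suc i k))
  loop c (suc i) k {x} {suc w} e =
    dec-c (c 0 _ refl) ⨾ dec-b (c 1 _ refl) ⨾ inc-a (c 2 _ refl) ⨾ jump z1 a≢1 b≢1 n≢1 (c 3 _ refl) ⨾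
    reach-≗ (loop c i (suc k) (cong next e)) (λ j → cong (λ m → S (proj₁ (unpair m)) (proj₂ (unpair m)) 0 j) (+-suc i k))

incB : ℕ → Prog
incB d = inc d ∷ []

inc-runs : ∀ d R → Runs (▪ (incB d)) R (update R d (suc (R d)))
inc-runs d R = runs λ c → inc-step (c 0 _ refl)

decB : ℕ → Prog
decB d = dec d 1 ∷ []

dec-runs : ∀ d R {w} → R d ≡ suc w → Runs (▪ (decB d)) R (update R d w)
dec-runs d R e = runs λ c → dec-suc-step (c 0 _ refl) e


-- In straight-line code the registers in use are listed explicitly:
-- get v rest holds the entries of v in its first registers and continues
-- with rest.  For concrete lists, updates then compute by evaluation.
get : List ℕ → Regs → Regs
get []      rest j       = rest j
get (x ∷ v) rest zero    = x
get (x ∷ v) rest (suc j) = get v rest j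

setL : List ℕ → ℕ → ℕ → List ℕ
setL []      i       x = []
setL (y ∷ v) zero    x = x ∷ v
setL (y ∷ v) (suc i) x = y ∷ setL v i x

length-setL : ∀ v i x → length (setL v i x) ≡ length v
length-setL []      i       x = refl
length-setL (y ∷ v) zero    x = refl
length-setL (y ∷ v) (suc i) x = cong suc (length-setL v i x)

update-get : ∀ v rest {i} x → i < length v → update (get v rest) i x ≗ get (setL v i x) rest
update-get (y ∷ v) rest {zero}  x i<len zero    = refl
update-get (y ∷ v) rest {zero}  x i<len (suc j) = refl
update-get (y ∷ v) rest {suc i} x i<len zero    = refl
update-get (y ∷ v) rest {suc i} x (s≤s i<len) (suc j) = update-get v rest x i<len j

update-get₂ : ∀ v rest {i j} x y → i < length v → j < length v →
              update (update (get v rest) i x) j y ≗ get (setL (setL v i x) j y) rest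
update-get₂ v rest {i} {j} x y i< j< k =
  trans (update-cong (update-get v rest x i<) j y k)
        (update-get (setL v i x) rest y (subst (j <_) (sym (length-setL v i x)) j<) k)

update-get₃ : ∀ v rest {i j l} x y z → i < length v → j < length v → l < length v →
              update (update (update (get v rest) i x) j y) l z ≗ get (setL (setL (setL v i x) j y) l z) rest
update-get₃ v rest {i} {j} {l} x y z i< j< l< k =
  trans (update-cong (update-get₂ v rest x y i< j<) l z k)
        (update-get (setL (setL v i x) j y) rest z
                    (subst (l <_) (sym (trans (length-setL (setL v i x) j y) (length-setL v i x))) l<) k)

-- Side conditions on concrete registers, checked by evaluation.
_≠_ : ℕ → ℕ → Set
a ≠ b = T (not (a ≡ᵇ b))

≠⇒≢ : ∀ {a b} → a ≠ b → a ≢ b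
≠⇒≢ {a} a≠b refl with a ≡ᵇ a in eq
... | true  = a≠b
... | false = ⊥-elim (subst T eq (≡⇒≡ᵇ a a refl))

_<ₗ_ : ℕ → List ℕ → Set
i <ₗ v = T (i <ᵇ length v)

<ₗ⇒< : ∀ i v → i <ₗ v → i < length v
<ₗ⇒< i v = <ᵇ⇒< i (length v)

IsZero : ℕ → Set
IsZero n = T (n ≡ᵇ 0)

isZero : ∀ n → IsZero n → n ≡ 0
isZero n = ≡ᵇ⇒≡ n 0

record RunsL (B : Block) (v : List ℕ) (rest : Regs) (v' : List ℕ) (rest' : Regs) : Set where
  constructor runsL
  field runs-listed : Runs B (get v rest) (get v' rest')
open RunsL public

infixr 3 _⟫ₗ_
_⟫ₗ_ : ∀ {A B v rest v₁ rest₁ v₂ rest₂} → RunsL A v rest v₁ rest₁ → RunsL B v₁ rest₁ v₂ rest₂ → RunsL (A ▸ B) v rest v₂ rest₂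
runsL first ⟫ₗ runsL second = runsL (first ⟫ second)

-- The listed registers after the macros.  (Each is a single function of v,
-- so that long chains of steps do not duplicate the lists they start from.)
afterInc afterDec : ℕ → List ℕ → Regs → List ℕ
afterInc d v rest = setL v d (suc (get v rest d))
afterDec d v rest = setL v d (pred (get v rest d))

afterLoad afterMove afterCopy : ℕ → ℕ → List ℕ → Regs → List ℕ
afterLoad d c v rest = setL v d (get v rest d + c)
afterMove s d v rest = setL (setL v d (get v rest d + get v rest s)) s 0
afterCopy s d v rest = setL v d (get v rest d + get v rest s)

afterPair : ℕ → ℕ → ℕ → List ℕ → Regs → List ℕ
afterPair a b n v rest = setL (setL (setL v a 0) b 0) n (get v rest n + pair (get v rest a) (get v rest b))

afterMoveOut : ℕ → ℕ → List ℕ → Regs → Regs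
afterMoveOut s m v rest = update rest m (rest m + get v rest s)

-- The macros on listed registers.  All side conditions are implicit and,
-- for concrete registers and lists, discharged by evaluation.
module _ {v : List ℕ} {rest : Regs} where

  incL : ∀ d {_ : d <ₗ v} → RunsL (▪ (incB d)) v rest (afterInc d v rest) rest
  incL d {d<} = runsL (runs-≗ (inc-runs d _) (update-get v rest _ (<ₗ⇒< d v d<)))

  decL : ∀ d {_ : d <ₗ v} {_ : T (0 <ᵇ get v rest d)} → RunsL (▪ (decB d)) v rest (afterDec d v rest) rest
  decL d {d<} {pos} = runsL (runs-≗ (dec-runs d _ (sym (suc-pred (get v rest d) ⦃ >-nonZero (<ᵇ⇒< 0 _ pos) ⦄)))
                                    (update-get v rest _ (<ₗ⇒< d v d<)))

  loadL : ∀ d c {_ : d <ₗ v} → RunsL (▪ (loadB d c)) v rest (afterLoad d c v rest) rest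
  loadL d c {d<} = runsL (runs-≗ (load-runs d c _) (update-get v rest _ (<ₗ⇒< d v d<)))

  moveL : ∀ s d {_ : s ≠ d} {_ : s ≠ 1} {_ : d ≠ 1} {_ : s <ₗ v} {_ : d <ₗ v} {_ : IsZero (get v rest 1)} →
          RunsL (▪ (moveB s d)) v rest (afterMove s d v rest) rest
  moveL s d {s≠d} {s≠1} {d≠1} {s<} {d<} {z} =
    runsL (runs-≗ (move-runs s d (≠⇒≢ s≠d) (≠⇒≢ s≠1) (≠⇒≢ d≠1) _ (isZero (get v rest 1) z))
                  (update-get₂ v rest _ 0 (<ₗ⇒< d v d<) (<ₗ⇒< s v s<)))

  clearL : ∀ d {_ : d ≠ 1} {_ : d <ₗ v} {_ : IsZero (get v rest 1)} → RunsL (▪ (clearB d)) v rest (setL v d 0) rest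
  clearL d {d≠1} {d<} {z} = runsL (runs-≗ (clear-runs d (≠⇒≢ d≠1) _ (isZero (get v rest 1) z)) (update-get v rest 0 (<ₗ⇒< d v d<)))

  copyL : ∀ s d t {_ : s ≠ d} {_ : s ≠ t} {_ : d ≠ t} {_ : s ≠ 1} {_ : d ≠ 1} {_ : t ≠ 1} {_ : d <ₗ v}
          {_ : IsZero (get v rest 1)} {_ : IsZero (get v rest t)} →
          RunsL (copyT s d t) v rest (afterCopy s d v rest) rest
  copyL s d t {s≠d} {s≠t} {d≠t} {s≠1} {d≠1} {t≠1} {d<} {z} {zt} =
    runsL (runs-≗ (copy-runs s d t (≠⇒≢ s≠d) (≠⇒≢ s≠t) (≠⇒≢ d≠t) (≠⇒≢ s≠1) (≠⇒≢ d≠1) (≠⇒≢ t≠1) _ (isZero (get v rest 1) z) (isZero (get v rest t) zt))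
                  (update-get v rest _ (<ₗ⇒< d v d<)))

  pairL : ∀ a b n {_ : a ≠ b} {_ : a ≠ n} {_ : b ≠ n} {_ : a ≠ 1} {_ : b ≠ 1} {_ : n ≠ 1}
          {_ : a <ₗ v} {_ : b <ₗ v} {_ : n <ₗ v} {_ : IsZero (get v rest 1)} →
          RunsL (▪ (pairB a b n)) v rest (afterPair a b n v rest) rest
  pairL a b n {a≠b} {a≠n} {b≠n} {a≠1} {b≠1} {n≠1} {a<} {b<} {n<} {z} =
    runsL (runs-≗ (pair-runs a b n (≠⇒≢ a≠b) (≠⇒≢ a≠n) (≠⇒≢ b≠n) (≠⇒≢ a≠1) (≠⇒≢ b≠1) (≠⇒≢ n≠1) _ (isZero (get v rest 1) z))
                  (update-get₃ v rest 0 0 _ (<ₗ⇒< a v a<) (<ₗ⇒< b v b<) (<ₗ⇒< n v n<)))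

  unpairL : ∀ n a b {_ : a ≠ b} {_ : a ≠ n} {_ : b ≠ n} {_ : a ≠ 1} {_ : b ≠ 1} {_ : n ≠ 1}
            {_ : a <ₗ v} {_ : b <ₗ v} {_ : n <ₗ v} {_ : IsZero (get v rest 1)}
            {_ : IsZero (get v rest a)} {_ : IsZero (get v rest b)} →
            ∀ x y → get v rest n ≡ pair x y →
            RunsL (▪ (unpairB n a b)) v rest (setL (setL (setL v a x) b y) n 0) rest
  unpairL n a b {a≠b} {a≠n} {b≠n} {a≠1} {b≠1} {n≠1} {a<} {b<} {n<} {z} {za} {zb} x y paired =
    runsL (runs-≗ (unpair-runs n a b (≠⇒≢ a≠b) (≠⇒≢ a≠n) (≠⇒≢ b≠n) (≠⇒≢ a≠1) (≠⇒≢ b≠1) (≠⇒≢ n≠1) _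
                               (isZero (get v rest 1) z) (isZero (get v rest a) za) (isZero (get v rest b) zb))
                  λ k → trans (cong (λ u → set3 a b n (get v rest) (proj₁ u) (proj₂ u) 0 k) (trans (cong unpair paired) (unpair-pair x y)))
                              (update-get₃ v rest x y 0 (<ₗ⇒< a v a<) (<ₗ⇒< b v b<) (<ₗ⇒< n v n<) k))

get-rest : ∀ v rest i → get v rest (length v + i) ≡ rest i
get-rest []      rest i = refl
get-rest (x ∷ v) rest i = get-rest v rest i

get-listed : ∀ v rest rest' {j} → j < length v → get v rest j ≡ get v rest' j
get-listed (x ∷ v) rest rest' {zero}  j<       = refl
get-listed (x ∷ v) rest rest' {suc j} (s≤s j<) = get-listed v rest rest' j<

update-get-rest : ∀ v rest i x → update (get v rest) (length v + i) x ≗ get v (update rest i x)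
update-get-rest []      rest i x j       = refl
update-get-rest (y ∷ v) rest i x zero    = refl
update-get-rest (y ∷ v) rest i x (suc j) = update-get-rest v rest i x j

get-setL-miss : ∀ v rest i x {j} → j ≢ i → get (setL v i x) rest j ≡ get v rest j
get-setL-miss []      rest i       x j≢i = refl
get-setL-miss (y ∷ v) rest zero    x {zero}  j≢i = ⊥-elim (j≢i refl)
get-setL-miss (y ∷ v) rest zero    x {suc j} j≢i = refl
get-setL-miss (y ∷ v) rest (suc i) x {zero}  j≢i = refl
get-setL-miss (y ∷ v) rest (suc i) x {suc j} j≢i = get-setL-miss v rest i x (λ j≡i → j≢i (cong suc j≡i))

relist : ∀ v rest (R : Regs) → (∀ j → j < length v → R j ≡ get v rest j) → R ≗ get v (λ j → R (length v + j))
relist []      rest R agree j       = refl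
relist (x ∷ v) rest R agree zero    = agree 0 (s≤s z≤n)
relist (x ∷ v) rest R agree (suc j) = relist v rest (λ k → R (suc k)) (λ k k< → agree (suc k) (s≤s k<)) j

wipe : ℕ → Regs → Regs
wipe zero    rest = rest
wipe (suc m) rest = update (wipe m rest) m 0

wipe-below : ∀ m rest {i} → i < m → wipe m rest i ≡ 0
wipe-below (suc m) rest {i} i<sm with i ≟ m
... | yes refl = update-hit (wipe i rest) i 0
... | no i≢m   = trans (update-miss (wipe m rest) m 0 i≢m) (wipe-below m rest (≤∧≢⇒< (≤-pred i<sm) i≢m))

clearsT : ℕ → ℕ → Block
clearsT base zero    = ▪ []
clearsT base (suc m) = clearsT base m ▸ ▪ (clearB (base + m))

module _ {v : List ℕ} {rest : Regs} where

  moveOutL : ∀ s m {_ : s ≠ (length v + m)} {_ : s ≠ 1} {_ : 1 <ₗ v} {_ : s <ₗ v} {_ : IsZero (get v rest 1)} →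
             RunsL (▪ (moveB s (length v + m))) v rest (setL v s 0) (afterMoveOut s m v rest)
  moveOutL s m {s≠d} {s≠1} {1<} {s<} {z} =
    runsL (runs-≗ (move-runs s d (≠⇒≢ s≠d) (≠⇒≢ s≠1) d≢1 _ (isZero (get v rest 1) z)) moved)
    where
    d : ℕ
    d = length v + m
    d≢1 : d ≢ 1
    d≢1 d≡1 = <-irrefl (sym d≡1) (≤-trans (<ₗ⇒< 1 v 1<) (m≤m+n (length v) m))
    moved : update (update (get v rest) d (get v rest d + get v rest s)) s 0 ≗ get (setL v s 0) (update rest m (rest m + get v rest s))
    moved j = trans (update-cong (λ k → trans (cong (λ a → update (get v rest) d (a + get v rest s) k) (get-rest v rest m))
                                              (update-get-rest v rest m _ k)) s 0 j)
                    (update-get v _ 0 (<ₗ⇒< s v s<) j)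

  clearsL : ∀ m {_ : 1 <ₗ v} {_ : IsZero (get v rest 1)} → RunsL (clearsT (length v) m) v rest v (wipe m rest)
  clearsL zero    = runsL (runs λ _ → reach-refl)
  clearsL (suc m) {1<} {z} =
    clearsL m {1<} {z} ⟫ₗ
    runsL (runs-≗ (clear-runs (length v + m) d≢1 _ (trans (get-listed v (wipe m rest) rest (<ₗ⇒< 1 v 1<)) (isZero _ z)))
                  (update-get-rest v (wipe m rest) m 0))
    where
    d≢1 : length v + m ≢ 1
    d≢1 d≡1 = <-irrefl (sym d≡1) (≤-trans (<ₗ⇒< 1 v 1<) (m≤m+n (length v) m))


-- A fixed program E is simulated with a step budget.  Register i of E lives
-- in host register K + i; the budget is counted down in FUEL; FLAG is
-- raised when E halts within the budget.
K FUEL FLAG : ℕ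
K    = 14
FUEL = 10
FLAG = 11

double : ℕ → ℕ
double zero    = zero
double (suc n) = suc (suc (double n))

-- Each instruction of E becomes two host instructions: a budget check
-- jumping to the exit, followed by the instruction with shifted registers
-- and doubled jump targets.  Jumps beyond the end of E (length L) go to its
-- end, where the final pair raises FLAG.
simI : ℕ → Instr → Instr
simI L (inc r)   = inc (K + r)
simI L (dec r j) = dec (K + r) (double (j ⊓ L))

simFrom : ℕ → Prog → Prog
simFrom L []       = dec FUEL (2 + double L) ∷ inc FLAG ∷ []
simFrom L (x ∷ xs) = dec FUEL (2 + double L) ∷ simI L x ∷ simFrom L xs

simB : Prog → Prog
simB E = simFrom (length E) E

length-simFrom : ∀ L E → length (simFrom L E) ≡ 2 + double (length E)
length-simFrom L []       = refl
length-simFrom L (x ∷ E) = cong (λ n → suc (suc n)) (length-simFrom L E)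

fetch-check : ∀ L E {i} → i ≤ length E → fetch (simFrom L E) (double i) ≡ just (dec FUEL (2 + double L))
fetch-check L []      {zero}  le       = refl
fetch-check L (x ∷ E) {zero}  le       = refl
fetch-check L (x ∷ E) {suc i} (s≤s le) = fetch-check L E le

fetch-instr : ∀ L E {i ins} → fetch E i ≡ just ins → fetch (simFrom L E) (suc (double i)) ≡ just (simI L ins)
fetch-instr L (x ∷ E) {zero}  refl = refl
fetch-instr L (x ∷ E) {suc i} e    = fetch-instr L E e

fetch-flag : ∀ L E → fetch (simFrom L E) (suc (double (length E))) ≡ just (inc FLAG)
fetch-flag L []      = refl
fetch-flag L (x ∷ E) = fetch-flag L E

fetch-just-< : ∀ (E : Prog) {j ins} → fetch E j ≡ just ins → j < length E
fetch-just-< (x ∷ E) {zero}  e = s≤s z≤n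
fetch-just-< (x ∷ E) {suc j} e = s≤s (fetch-just-< E e)

fetch-nothing-≥ : ∀ (E : Prog) {j} → fetch E j ≡ nothing → length E ≤ j
fetch-nothing-≥ []      e = z≤n
fetch-nothing-≥ (x ∷ E) {zero}  ()
fetch-nothing-≥ (x ∷ E) {suc j} e = s≤s (fetch-nothing-≥ E e)

run-⊓ : ∀ k E j r → run k E j r ≡ run k E (j ⊓ length E) r
run-⊓ zero    E j r = refl
run-⊓ (suc k) E j r with ≤-total j (length E)
... | inj₁ j≤L rewrite m≤n⇒m⊓n≡m j≤L = refl
... | inj₂ L≤j rewrite m≥n⇒m⊓n≡n L≤j | fetch-beyond E L≤j | fetch-beyond E (≤-refl {length E}) = refl

-- An upper bound on the registers used by E (and at least 1, for the input).
register : Instr → ℕ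
register (inc r)   = r
register (dec r j) = r

regBound : Prog → ℕ
regBound []      = 1
regBound (x ∷ E) = suc (register x) ⊔ regBound E

regBound-instr : ∀ E {i ins} → fetch E i ≡ just ins → register ins < regBound E
regBound-instr (x ∷ E) {zero}  refl = m≤m⊔n (suc (register x)) (regBound E)
regBound-instr (x ∷ E) {suc i} e    = ≤-trans (regBound-instr E e) (m≤n⊔m (suc (register x)) (regBound E))

regBound-pos : ∀ E → 0 < regBound E
regBound-pos []      = s≤s z≤n
regBound-pos (x ∷ E) = ≤-trans (s≤s z≤n) (m≤m⊔n (suc (register x)) (regBound E))

Mirrors : ℕ → Regs → Regs → Set
Mirrors M R r = ∀ i → i < M → R (K + i) ≡ r i

mirror-set : ∀ {M R r} q {v} → Mirrors M R r → Mirrors M (update R (K + q) v) (update r q v)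
mirror-set q m i i<M with i ≡ᵇ q
... | true  = refl
... | false = m i i<M

Frame : Regs → Regs → Set
Frame R R' = ∀ j → j < K → j ≢ FUEL → j ≢ FLAG → R' j ≡ R j

frame-refl : ∀ {R} → Frame R R
frame-refl j _ _ _ = refl

frame-trans : ∀ {R R₁ R₂} → Frame R R₁ → Frame R₁ R₂ → Frame R R₂
frame-trans f g j j<K j≢fuel j≢flag = trans (g j j<K j≢fuel j≢flag) (f j j<K j≢fuel j≢flag)

frame-fuel : ∀ R v → Frame R (update R FUEL v)
frame-fuel R v j _ j≢fuel _ = update-miss R FUEL v j≢fuel

frame-flag : ∀ R v → Frame R (update R FLAG v)
frame-flag R v j _ _ j≢flag = update-miss R FLAG v j≢flag

frame-mirror : ∀ R q v → Frame R (update R (K + q) v)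
frame-mirror R q v j j<K _ _ = update-miss R (K + q) v λ j≡K+q → <-irrefl j≡K+q (≤-trans j<K (m≤m+n K q))

flag : Maybe ℕ → ℕ
flag (just _) = 1
flag nothing  = 0

module Simulate (E : Prog) {p : Prog} {o : ℕ} (c : Contains p o (simB E)) where

  L M : ℕ
  L = length E
  M = regBound E

  record Outcome (R : Regs) (pc : ℕ) (q : Maybe ℕ) : Set where
    constructor outcome
    field
      final   : Regs
      reaches : Reach p pc R (2 + double L + o) final
      flagged : final FLAG ≡ flag q
      framed  : Frame R final

  prefix : ∀ {R R₁ pc pc' q} → Reach p pc R pc' R₁ → Frame R R₁ → Outcome R₁ pc' q → Outcome R pc q
  prefix steps f (outcome R' reach flagged f') = outcome R' (steps ⨾ reach) flagged (frame-trans f f')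

  budget-check : ∀ {k pc} R → pc ≤ L → R FUEL ≡ suc k → Reach p (double pc + o) R (suc (double pc) + o) (update R FUEL k)
  budget-check R pc≤L fuel = dec-suc-step (c (double _) _ (fetch-check L E pc≤L)) fuel

  simulate : ∀ k pc r R → pc ≤ L → R FUEL ≡ k → R FLAG ≡ 0 → Mirrors M R r →
             Outcome R (double pc + o) (run k E pc r)
  simulate zero pc r R pc≤L fuel flag0 m =
    outcome R (dec-zero-step (c (double pc) _ (fetch-check L E pc≤L)) fuel) flag0 frame-refl
  simulate (suc k) pc r R pc≤L fuel flag0 m with fetch E pc in fe
  ... | nothing =
    prefix (budget-check R pc≤L fuel) (frame-fuel R k)
      (outcome (update R₁ FLAG (suc (R FLAG)))
               (reach-at (cong (λ n → double n + o) pc≡L) (inc-step {r = R₁} (c (suc (double pc)) _ halt-instr)))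
               (cong suc flag0) (frame-flag R₁ (suc (R FLAG))))
    where
    R₁ : Regs
    R₁ = update R FUEL k
    pc≡L : suc pc ≡ suc L
    pc≡L = cong suc (≤-antisym pc≤L (fetch-nothing-≥ E fe))
    halt-instr : fetch (simB E) (suc (double pc)) ≡ just (inc FLAG)
    halt-instr = subst (λ n → fetch (simB E) (suc (double n)) ≡ just (inc FLAG))
                       (sym (≤-antisym pc≤L (fetch-nothing-≥ E fe))) (fetch-flag L E)
  ... | just (inc q) =
    prefix (budget-check R pc≤L fuel ⨾ inc-step (c (suc (double pc)) _ (fetch-instr L E fe)))
           (frame-trans (frame-fuel R k) (frame-mirror R₁ q _))
           (subst (λ v → Outcome R₂ _ (run k E (suc pc) (update r q (suc v)))) (m q (regBound-instr E fe))
                  (simulate k (suc pc) (update r q (suc (R (K + q)))) R₂ (fetch-just-< E fe) refl flag0 (mirror-set {R = R₁} q m)))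
    where
    R₁ R₂ : Regs
    R₁ = update R FUEL k
    R₂ = update R₁ (K + q) (suc (R (K + q)))
  ... | just (dec q j) with r q in rq
  ...   | zero =
    prefix (budget-check R pc≤L fuel ⨾ dec-zero-step (c (suc (double pc)) _ (fetch-instr L E fe)) (trans (m q (regBound-instr E fe)) rq))
           (frame-fuel R k)
           (subst (Outcome R₁ _) (sym (run-⊓ k E j r)) (simulate k (j ⊓ L) r R₁ (m⊓n≤n j L) refl flag0 m))
    where
    R₁ : Regs
    R₁ = update R FUEL k
  ...   | suc v =
    prefix (budget-check R pc≤L fuel ⨾ dec-suc-step (c (suc (double pc)) _ (fetch-instr L E fe)) (trans (m q (regBound-instr E fe)) rq))
           (frame-trans (frame-fuel R k) (frame-mirror R₁ q v))
           (simulate k (suc pc) (update r q v) (update R₁ (K + q) v) (fetch-just-< E fe) refl flag0 (mirror-set {R = R₁} q m))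
    where
    R₁ : Regs
    R₁ = update R FUEL k


-- The working registers of the programs built below:
--   0 input and output,   1 always zero,   2 x,   3 s,   4 5 6 13 scratch,
--   7 the search counter c,   8 the search candidate w,   9 temporary,
--   10 FUEL,   11 FLAG,   12 the code i of the main block;
-- from K = 14 on, the registers of the simulated program.
layout : (x s i c w fl : ℕ) → List ℕ
layout x s i c w fl = 0 ∷ 0 ∷ x ∷ s ∷ 0 ∷ 0 ∷ 0 ∷ c ∷ w ∷ 0 ∷ 0 ∷ fl ∷ i ∷ 0 ∷ []

-- The search loop around a body block B:
--   while c ≠ 0: c := c - 1; run B; if FLAG then (FLAG := 0; exit) else w := w + 1.
tailB : ℕ → Prog
tailB lb = dec FLAG (3 + lb) ∷ dec 1 (5 + lb) ∷ inc 8 ∷ dec 1 0 ∷ []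

loopB : Prog → Prog
loopB B = (dec 7 (5 + length B) ∷ []) ++ map (reloc 1) B ++ tailB (length B)

length-loopB : ∀ B → length (loopB B) ≡ 5 + length B
length-loopB B = cong suc (trans (length-++ (map (reloc 1) B)) (trans (cong (_+ 4) (length-map _ B)) (+-comm (length B) 4)))

search : (ℕ → Maybe ℕ) → ℕ → ℕ → ℕ
search test zero    w = w
search test (suc c) w with test w
... | just _  = w
... | nothing = search test c (suc w)

Passes : (ℕ → Maybe ℕ) → ℕ → Set
Passes test w = ∃[ v ] (test w ≡ just v)

search-≤ : ∀ test c w → search test c w ≤ c + w
search-≤ test zero    w = ≤-refl
search-≤ test (suc c) w with test w
... | just _  = ≤-trans (m≤n+m w c) (n≤1+n _)
... | nothing = subst (search test c (suc w) ≤_) (+-suc c w) (search-≤ test c (suc w))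

search-result : ∀ test c w → search test c w ≡ c + w ⊎ Passes test (search test c w)
search-result test zero    w = inj₁ refl
search-result test (suc c) w with test w in passed
... | just v  = inj₂ (v , passed)
... | nothing with search-result test c (suc w)
...   | inj₁ exhausted = inj₁ (trans exhausted (+-suc c w))
...   | inj₂ found     = inj₂ found

search-≤-passing : ∀ test {b} → Passes test b → ∀ c w → w ≤ b → b < c + w → search test c w ≤ b
search-≤-passing test pb zero w w≤b b<w = ⊥-elim (<-irrefl refl (≤-trans b<w w≤b))
search-≤-passing test {b} (v , pb) (suc c) w w≤b b<c+w with test w in passed
... | just _  = w≤b
... | nothing with m≤n⇒m<n∨m≡n w≤b
...   | inj₁ w<b  = search-≤-passing test (v , pb) c (suc w) w<b (subst (b <_) (sym (+-suc c w)) b<c+w)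
...   | inj₂ refl = case (trans (sym passed) pb)
  where case : nothing ≡ just v → search test c (suc w) ≤ b
        case ()

module SearchLoop (test : ℕ → ℕ → ℕ → Maybe ℕ) (B : Prog)
  (body : ∀ {p o} → Contains p o B → ∀ x s i c w rest →
          ∃[ rest' ] Reach p o (get (layout x s i c w 0) rest) (length B + o) (get (layout x s i c w (flag (test x s w))) rest'))
  {p : Prog} {o : ℕ} (c : Contains p o (loopB B)) where

  lb after-body : ℕ
  lb = length B
  after-body = lb + suc o

  c-body : Contains p (1 + o) B
  c-body = contains-middle {p} {o} (dec 7 (5 + lb) ∷ []) B (tailB lb) c

  tail-at : ∀ t {ins} → fetch (tailB lb) t ≡ just ins → fetch p (t + after-body) ≡ just (reloc o ins)
  tail-at t {ins} e = trans (cong (fetch p) position) (c (suc (lb + t)) ins in-loop)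
    where
    position : t + after-body ≡ suc (lb + t) + o
    position = trans (cong (t +_) (+-suc lb o))
               (trans (+-suc t (lb + o)) (cong suc (trans (sym (+-assoc t lb o)) (cong (_+ o) (+-comm t lb)))))
    in-loop : fetch (loopB B) (suc (lb + t)) ≡ just ins
    in-loop = trans (cong (λ l → fetch (map (reloc 1) B ++ tailB lb) (l + t)) (sym (length-map (reloc 1) B)))
                    (trans (fetch-++ʳ (map (reloc 1) B) (tailB lb) t) e)

  exit : 5 + lb + o ≡ length (loopB B) + o
  exit = cong (_+ o) (sym (length-loopB B))

  listed : ∀ j {_ : T (j <ᵇ 14)} → j < 14
  listed j {j<} = <ᵇ⇒< j 14 j<

  loop : ∀ x s i c w rest → ∃[ c' ] ∃[ rest' ]
         Reach p o (get (layout x s i c w 0) rest) (length (loopB B) + o) (get (layout x s i c' (search (test x s) c w) 0) rest')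
  loop x s i zero    w rest = 0 , rest , reach-at exit (dec-zero-step (c 0 _ refl) refl)
  loop x s i (suc n) w rest with test x s w | body c-body x s i n w rest
  ... | just _  | rest₁ , run-body =
    n , rest₁ ,
    reach-≗ (dec-suc-step (c 0 _ refl) refl) (update-get (layout x s i (suc n) w 0) rest n (listed 7)) ⨾
    run-body ⨾
    reach-≗ (dec-suc-step (tail-at 0 refl) refl) (update-get (layout x s i n w 1) rest₁ 0 (listed 11)) ⨾
    reach-at exit (dec-zero-step (tail-at 1 refl) refl)
  ... | nothing | rest₁ , run-body with loop x s i n (suc w) rest₁
  ...   | c' , rest' , continue =
    c' , rest' ,
    reach-≗ (dec-suc-step (c 0 _ refl) refl) (update-get (layout x s i (suc n) w 0) rest n (listed 7)) ⨾
    run-body ⨾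
    reach-at (cong (λ n → suc (suc n)) (sym (+-suc lb o))) (dec-zero-step (tail-at 0 refl) refl) ⨾
    reach-≗ (inc-step (tail-at 2 refl)) (update-get (layout x s i n w 0) rest₁ (suc w) (listed 8)) ⨾
    dec-zero-step (tail-at 3 refl) refl ⨾
    continue

module SearchFor (E : Prog) where

  M : ℕ
  M = regBound E

  attempt : ℕ → ℕ → ℕ → Maybe ℕ
  attempt x s w = run s E 0 (initRegs (pair x w))

  -- One search step: load pair x w as input of E, the budget s as fuel,
  -- simulate E, and discard the unused fuel.  FLAG records whether E halted.
  setupT : Block
  setupT = copyT 2 5 9 ▸ copyT 8 6 9 ▸ ▪ (pairB 5 6 4) ▸ clearsT K M ▸ ▪ (moveB 4 K) ▸ copyT 3 FUEL 9

  bodyT : Block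
  bodyT = setupT ▸ ▪ (simB E) ▸ ▪ (clearB FUEL)

  setupL : ∀ x s i c w rest →
           RunsL setupT (layout x s i c w 0) rest
                 (0 ∷ 0 ∷ x ∷ s ∷ 0 ∷ 0 ∷ 0 ∷ c ∷ w ∷ 0 ∷ s ∷ 0 ∷ i ∷ 0 ∷ []) (update (wipe M rest) 0 (wipe M rest 0 + pair x w))
  setupL x s i c w rest = copyL 2 5 9 ⟫ₗ copyL 8 6 9 ⟫ₗ pairL 5 6 4 ⟫ₗ clearsL M ⟫ₗ moveOutL 4 0 ⟫ₗ copyL 3 FUEL 9

  body-reach : ∀ {p o} → Contains p o (flat bodyT) → ∀ x s i c w rest →
               ∃[ rest' ] Reach p o (get (layout x s i c w 0) rest) (length (flat bodyT) + o)
                                    (get (layout x s i c w (flag (attempt x s w))) rest')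
  body-reach {p} {o} c x s i cnt w rest =
    (λ j → final (14 + j)) ,
    sequence setupT (▪ (simB E) ▸ ▪ (clearB FUEL)) c (run-block (runs-listed (setupL x s i cnt w rest)))
      λ c′ → sequence (▪ (simB E)) (▪ (clearB FUEL)) c′
               (λ _ → reach-at (cong (_+ o₁) (sym (length-simFrom (length E) E))) (reach-≗ reaches relisted))
               (run-block (runs-listed (clearL {v₂} {λ j → final (14 + j)} FUEL)))
    where
    v₁ : List ℕ
    v₁ = 0 ∷ 0 ∷ x ∷ s ∷ 0 ∷ 0 ∷ 0 ∷ cnt ∷ w ∷ 0 ∷ s ∷ 0 ∷ i ∷ 0 ∷ []
    rest₁ : Regs
    rest₁ = update (wipe M rest) 0 (wipe M rest 0 + pair x w)
    o₁ : ℕ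
    o₁ = length (flat setupT) + o

    mirrors : Mirrors M (get v₁ rest₁) (initRegs (pair x w))
    mirrors zero    _   = cong (_+ pair x w) (wipe-below M rest (regBound-pos E))
    mirrors (suc j) j<M = wipe-below M rest j<M

    c-sim : Contains p o₁ (simB E)
    c-sim = contains-⊕ˡ {p} {o₁} (simB E) (clearB FUEL) (contains-⊕ʳ {p} {o} (flat setupT) _ c)

    open Simulate E {p} {o₁} c-sim
    open Outcome (simulate s 0 (initRegs (pair x w)) (get v₁ rest₁) z≤n refl refl mirrors)

    fl : ℕ
    fl = flag (attempt x s w)
    v₂ : List ℕ
    v₂ = setL (setL v₁ FUEL (final FUEL)) FLAG fl

    relisted : final ≗ get v₂ (λ j → final (14 + j))
    relisted = relist v₂ rest₁ final agree
      where
      agree : ∀ j → j < 14 → final j ≡ get v₂ rest₁ j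
      agree j j<14 with j ≟ FLAG | j ≟ FUEL
      ... | yes refl | _        = flagged
      ... | no _     | yes refl = refl
      ... | no j≢fl  | no j≢fu  = trans (framed j j<14 j≢fu j≢fl)
                                        (sym (trans (get-setL-miss (setL v₁ FUEL (final FUEL)) rest₁ FLAG fl j≢fl) (get-setL-miss v₁ rest₁ FUEL _ j≢fu)))

  searchB : Prog
  searchB = loopB (flat bodyT)

  candidate : ℕ → ℕ → ℕ
  candidate s x = search (attempt x s) x 0

  search-reach : ∀ {p o} → Contains p o searchB → ∀ x s i rest → ∃[ c' ] ∃[ rest' ]
                 Reach p o (get (layout x s i x 0 0) rest) (length searchB + o) (get (layout x s i c' (candidate s x) 0) rest')
  search-reach c x s i = SearchLoop.loop attempt (flat bodyT) body-reach c x s i x 0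


-- The data of a node program: a jump over two instructions that are never
-- executed and only store the numbers x and s in the program text.
header : ℕ → ℕ → Prog
header x s = dec 1 3 ∷ inc x ∷ inc s ∷ []

-- Decoding the code encWith (header x s) i of a node program (its own
-- code, as κ runs a program on itself) into x, s and i.
popT : Block
popT = ▪ (decB 4) ▸ ▪ (unpairB 4 5 6)

operandT : Block
operandT = ▪ (moveB 5 4) ▸ ▪ (unpairB 4 5 6)

decodeT : Block
decodeT = ▪ (moveB 0 4) ▸ popT ▸ ▪ (clearB 5) ▸ ▪ (moveB 6 4) ▸ popT ▸ ▪ (moveB 6 12) ▸ operandT ▸ ▪ (moveB 6 2) ▸
          ▪ (moveB 12 4) ▸ popT ▸ ▪ (moveB 6 12) ▸ operandT ▸ ▪ (moveB 6 3) ▸ copyT 2 7 9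

decodeL : ∀ x s i rest → RunsL decodeT (encWith (header x s) i ∷ replicate 13 0) rest (layout x s i x 0 0) rest
decodeL x s i rest =
  moveL 0 4 ⟫ₗ
  (decL 4 ⟫ₗ unpairL 4 5 6 (encI (dec 1 3)) t₁ refl) ⟫ₗ clearL 5 ⟫ₗ moveL 6 4 ⟫ₗ
  (decL 4 ⟫ₗ unpairL 4 5 6 (pair 0 x) t₂ refl) ⟫ₗ moveL 6 12 ⟫ₗ
  (moveL 5 4 ⟫ₗ unpairL 4 5 6 0 x refl) ⟫ₗ moveL 6 2 ⟫ₗ moveL 12 4 ⟫ₗ
  (decL 4 ⟫ₗ unpairL 4 5 6 (pair 0 s) i refl) ⟫ₗ moveL 6 12 ⟫ₗ
  (moveL 5 4 ⟫ₗ unpairL 4 5 6 0 s refl) ⟫ₗ moveL 6 3 ⟫ₗ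
  copyL 2 7 9
  where
  t₁ t₂ : ℕ
  t₁ = encWith (inc x ∷ inc s ∷ []) i
  t₂ = encWith (inc s ∷ []) i

-- Building the code encWith (header w s) i of a node program from w, s
-- (registers 8 and 3) and i (register 4) into register 0.
incCodeT : ℕ → Block          -- register 5 := encI (inc (R src))
incCodeT src = copyT src 6 9 ▸ ▪ (pairB 5 6 13) ▸ ▪ (moveB 13 5)

consT : Block                 -- prepend the instruction code in 5 to the code in 4
consT = ▪ (moveB 4 6) ▸ ▪ (pairB 5 6 4) ▸ ▪ (incB 4)

buildT : Block
buildT = incCodeT 3 ▸ consT ▸ incCodeT 8 ▸ consT ▸ ▪ (loadB 5 (encI (dec 1 3))) ▸ consT ▸ ▪ (moveB 4 0)

buildL : ∀ a s i c w rest →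
         RunsL buildT (0 ∷ 0 ∷ a ∷ s ∷ i ∷ 0 ∷ 0 ∷ c ∷ w ∷ 0 ∷ 0 ∷ 0 ∷ 0 ∷ 0 ∷ []) rest
                      (encWith (header w s) i ∷ 0 ∷ a ∷ s ∷ 0 ∷ 0 ∷ 0 ∷ c ∷ w ∷ 0 ∷ 0 ∷ 0 ∷ 0 ∷ 0 ∷ []) rest
buildL a s i c w rest =
  (copyL 3 6 9 ⟫ₗ pairL 5 6 13 ⟫ₗ moveL 13 5) ⟫ₗ (moveL 4 6 ⟫ₗ pairL 5 6 4 ⟫ₗ incL 4) ⟫ₗ
  (copyL 8 6 9 ⟫ₗ pairL 5 6 13 ⟫ₗ moveL 13 5) ⟫ₗ (moveL 4 6 ⟫ₗ pairL 5 6 4 ⟫ₗ incL 4) ⟫ₗ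
  loadL 5 (encI (dec 1 3)) ⟫ₗ (moveL 4 6 ⟫ₗ pairL 5 6 4 ⟫ₗ incL 4) ⟫ₗ moveL 4 0

contains-self : ∀ p → Contains p 0 p
contains-self p i (inc x)   e = trans (cong (fetch p) (+-identityʳ i)) e
contains-self p i (dec x j) e = trans (cong (fetch p) (+-identityʳ i)) (trans e (cong (λ t → just (dec x t)) (sym (+-identityʳ j))))

initRegs-listed : ∀ n → initRegs n ≗ get (n ∷ replicate 13 0) (λ _ → 0)
initRegs-listed n zero    = refl
initRegs-listed n (suc j) = sym (zeros 13 j)
  where zeros : ∀ m j → get (replicate m 0) (λ _ → 0) j ≡ 0
        zeros zero    j       = refl
        zeros (suc m) zero    = refl
        zeros (suc m) (suc j) = zeros m j

halts-with : ∀ (B : Block) n {v rest v' rest'} → initRegs n ≗ get v rest → RunsL B v rest v' rest' →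
             ∃[ k ] (run k (flat B) 0 (initRegs n) ≡ just (get v' rest' 0))
halts-with B n start (runsL (runs block)) =
  reach-halt (≗-reach start (block (contains-self (flat B)))) (fetch-beyond (flat B) (≤-reflexive (sym (+-identityʳ _))))

module Nodes (E : Prog) where
  open SearchFor E

  finishT : Block
  finishT = ▪ (incB 3) ▸ ▪ (moveB 12 4) ▸ buildT

  mainT : Block
  mainT = decodeT ▸ ▪ searchB ▸ finishT

  -- The main block as placed after the header.  It is kept opaque: its
  -- code is an enormous number that must never be computed.
  opaque
    mainProg : Prog
    mainProg = map (reloc 3) (flat mainT)

  opaque
    unfolding mainProg
    mainProg-def : mainProg ≡ map (reloc 3) (flat mainT)
    mainProg-def = refl

  nodeProg : ℕ → ℕ → Prog
  nodeProg x s = header x s ++ mainProg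

  mainCode : ℕ
  mainCode = enc mainProg

  node : ℕ → ℕ → ℕ
  node x s = encWith (header x s) mainCode

  prog-node : ∀ x s → prog (node x s) ≡ nodeProg x s
  prog-node x s = begin
    prog (encWith (header x s) (enc mainProg)) ≡⟨ cong prog (sym (enc-++ (header x s) mainProg)) ⟩
    prog (enc (header x s ++ mainProg))        ≡⟨ prog-enc (header x s ++ mainProg) ⟩
    nodeProg x s                               ∎
    where open ≡-Reasoning

  finishL : ∀ x s c w rest →
            RunsL finishT (layout x s mainCode c w 0) rest
                          (node w (suc s) ∷ 0 ∷ x ∷ suc s ∷ 0 ∷ 0 ∷ 0 ∷ c ∷ w ∷ 0 ∷ 0 ∷ 0 ∷ 0 ∷ 0 ∷ []) rest
  finishL x s c w rest = incL 3 ⟫ₗ moveL 12 4 ⟫ₗ buildL x (suc s) mainCode c w rest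

  node-step : ∀ x s → node x s · node x s ↦ node (candidate s x) (suc s)
  node-step x s = subst (λ q → ∃[ k ] (run k q 0 (initRegs (node x s)) ≡ just (node (candidate s x) (suc s))))
                        (sym (prog-node x s)) halts
    where
    p : Prog
    p = nodeProg x s

    c-main : Contains p 3 (flat mainT)
    c-main = subst (λ q → Contains q 3 (flat mainT)) (sym (cong (header x s ++_) mainProg-def))
                   (contains-⊕ʳ {header x s ⊕ flat mainT} {0} (header x s) (flat mainT) (contains-self (header x s ⊕ flat mainT)))

    c-search : Contains p (length (flat decodeT) + 3) searchB
    c-search = contains-⊕ˡ {p} searchB (flat finishT) (contains-⊕ʳ {p} {3} (flat decodeT) (flat (▪ searchB ▸ finishT)) c-main)

    length-p : length p ≤ length (flat mainT) + 3
    length-p = ≤-reflexive (trans (cong (λ q → 3 + length q) mainProg-def) (trans (cong (3 +_) (length-map (reloc 3) (flat mainT))) (+-comm 3 _)))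

    start : Regs
    start = get (node x s ∷ replicate 13 0) (λ _ → 0)

    decoded : Regs
    decoded = get (layout x s mainCode x 0 0) (λ _ → 0)

    Searched : Set
    Searched = ∃[ c' ] ∃[ rest' ] Reach p (length (flat decodeT) + 3) decoded (length searchB + (length (flat decodeT) + 3))
                                         (get (layout x s mainCode c' (candidate s x) 0) rest')

    halts-after : Searched → ∃[ k ] (run k p 0 (initRegs (node x s)) ≡ just (node (candidate s x) (suc s)))
    halts-after (c' , rest' , searched) =
      reach-halt {r' = finished} (≗-reach (initRegs-listed (node x s)) (dec-zero-step {r = start} refl refl ⨾ main)) (fetch-beyond p length-p)
      where
      finished : Regs
      finished = get (node (candidate s x) (suc s) ∷ 0 ∷ x ∷ suc s ∷ 0 ∷ 0 ∷ 0 ∷ c' ∷ candidate s x ∷ 0 ∷ 0 ∷ 0 ∷ 0 ∷ 0 ∷ []) rest'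
      main : Reach p 3 start (length (flat mainT) + 3) finished
      main = sequence {R₁ = decoded} decodeT (▪ searchB ▸ finishT) c-main
               (run-block (runs-listed (decodeL x s mainCode (λ _ → 0))))
               λ c₁ → sequence {R₁ = get (layout x s mainCode c' (candidate s x) 0) rest'} (▪ searchB) finishT c₁
                        (λ _ → searched) (run-block (runs-listed (finishL x s c' (candidate s x) rest')))

    halts : ∃[ k ] (run k p 0 (initRegs (node x s)) ≡ just (node (candidate s x) (suc s)))
    halts = halts-after (search-reach c-search x s mainCode (λ _ → 0))

  startT : Block
  startT = ▪ (moveB 0 8) ▸ ▪ (loadB 4 mainCode) ▸ buildT

  start-computes : ∀ x → enc (flat startT) · x ↦ node x 0
  start-computes x = subst (λ q → ∃[ k ] (run k q 0 (initRegs x) ≡ just (node x 0))) (sym (prog-enc (flat startT)))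
                           (halts-with startT x {x ∷ replicate 13 0} {λ _ → 0} (initRegs-listed x) (moveL 0 8 ⟫ₗ loadL 4 mainCode ⟫ₗ buildL 0 0 mainCode 0 x (λ _ → 0)))


stored : Prog → ℕ
stored (_ ∷ inc x ∷ _) = x
stored _               = 0

module Reduction (R : Rel ℕ 0ℓ) (isEquivalence : IsEquivalence R) (e : ℕ)
  (enumerates : ∀ x y → R x y ⇔ (∃[ n ] (unpair n ≡ (x , y) × ∃[ v ] (e · n ↦ v)))) where

  open IsEquivalence isEquivalence renaming (refl to R-refl; sym to R-sym; trans to R-trans)
  open SearchFor (prog e)
  open Nodes (prog e)

  passes⇒R : ∀ {x s w} → Passes (attempt x s) w → R x w
  passes⇒R {x} {s} {w} (v , halted) = Equivalence.from (enumerates x w) (pair x w , unpair-pair x w , v , s , halted)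

  R⇒passes : ∀ {a b} → R a b → ∃[ t ] Passes (attempt a t) b
  R⇒passes {a} {b} r = witness (Equivalence.to (enumerates a b) r)
    where
    witness : ∃[ n ] (unpair n ≡ (a , b) × ∃[ v ] (e · n ↦ v)) → ∃[ t ] Passes (attempt a t) b
    witness (n , coded , v , t , halted) =
      t , v , subst (λ m → run t (prog e) 0 (initRegs m) ≡ just v) (unpair-injective {n} {pair a b} (trans coded (sym (unpair-pair a b)))) halted

  passes-mono : ∀ {a s s' b} → s ≤ s' → Passes (attempt a s) b → Passes (attempt a s') b
  passes-mono s≤s' (v , halted) = v , run-mono-≤ (prog e) 0 _ s≤s' halted

  candidate-≤ : ∀ s x → candidate s x ≤ x
  candidate-≤ s x = subst (candidate s x ≤_) (+-identityʳ x) (search-≤ (attempt x s) x 0)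

  candidate-R : ∀ s x → R x (candidate s x)
  candidate-R s x with search-result (attempt x s) x 0
  ... | inj₁ exhausted = subst (R x) (sym (trans exhausted (+-identityʳ x))) R-refl
  ... | inj₂ found     = passes⇒R {s = s} found

  orbit : ℕ → ℕ → ℕ → ℕ
  orbit st zero    a = a
  orbit st (suc j) a = orbit (suc st) j (candidate st a)

  orbit-≤ : ∀ st j a → orbit st j a ≤ a
  orbit-≤ st zero    a = ≤-refl
  orbit-≤ st (suc j) a = ≤-trans (orbit-≤ (suc st) j (candidate st a)) (candidate-≤ st a)

  orbit-R : ∀ st j a → R a (orbit st j a)
  orbit-R st zero    a = R-refl
  orbit-R st (suc j) a = R-trans (candidate-R st a) (orbit-R (suc st) j (candidate st a))

  orbit-+ : ∀ m st j a → orbit st (m + j) a ≡ orbit (m + st) j (orbit st m a)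
  orbit-+ zero    st j a = refl
  orbit-+ (suc m) st j a = trans (orbit-+ m (suc st) j (candidate st a))
                                 (cong (λ t → orbit t j (orbit (suc st) m (candidate st a))) (+-suc m st))

  orbit-last : ∀ st t a → orbit st (suc t) a ≡ candidate (t + st) (orbit st t a)
  orbit-last st t a = trans (cong (λ k → orbit st k a) (+-comm 1 t)) (orbit-+ t st 1 a)

  -- Equivalent elements have orbits that eventually meet: if R a b with
  -- b < a, then after E halts on pair a b within the budget, the candidate
  -- from a drops below a; conclude by induction on a + b.
  meet-below : ∀ n st a b → a + b ≤ n → R a b → b < a →
               (∀ st a b → a + b < n → R a b → ∃[ j ] orbit st j a ≡ orbit st j b) →
               ∃[ j ] orbit st j a ≡ orbit st j b
  meet-below n st a b a+b≤n r b<a meet = suc t + j , trans (orbit-+ (suc t) st j a) (trans met (sym (orbit-+ (suc t) st j b)))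
    where
    t a₁ a₂ b₂ : ℕ
    t = proj₁ (R⇒passes r)
    a₁ = orbit st t a
    a₂ = orbit st (suc t) a
    b₂ = orbit st (suc t) b
    a₂<a : a₂ < a
    a₂<a with m≤n⇒m<n∨m≡n (orbit-≤ st t a)
    ... | inj₁ a₁<a = subst (_< a) (sym (orbit-last st t a)) (≤-<-trans (candidate-≤ (t + st) a₁) a₁<a)
    ... | inj₂ a₁≡a = subst (_< a) (sym (trans (orbit-last st t a) (cong (candidate (t + st)) a₁≡a)))
                        (≤-<-trans (search-≤-passing (attempt a (t + st)) (passes-mono {a = a} (m≤m+n t st) (proj₂ (R⇒passes r)))
                                                     a 0 z≤n (subst (b <_) (sym (+-identityʳ a)) b<a))
                                   b<a)
    smaller : a₂ + b₂ < n
    smaller = <-≤-trans (+-mono-<-≤ a₂<a (orbit-≤ st (suc t) b)) a+b≤n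
    recurse : ∃[ j ] orbit (suc t + st) j a₂ ≡ orbit (suc t + st) j b₂
    recurse = meet (suc t + st) a₂ b₂ smaller (R-trans (R-sym (orbit-R st (suc t) a)) (R-trans r (orbit-R st (suc t) b)))
    j : ℕ
    j = proj₁ recurse
    met : orbit (suc t + st) j a₂ ≡ orbit (suc t + st) j b₂
    met = proj₂ recurse

  meet : ∀ n st a b → a + b < n → R a b → ∃[ j ] orbit st j a ≡ orbit st j b
  meet (suc n) st a b (s≤s a+b≤n) r with <-cmp a b
  ... | tri≈ _ a≡b _ = 0 , a≡b
  ... | tri> _ _ b<a = meet-below n st a b a+b≤n r b<a (meet n)
  ... | tri< a<b _ _ with meet-below n st b a (subst (_≤ n) (+-comm a b) a+b≤n) (R-sym r) a<b (meet n)
  ...   | j , met = j , sym met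

  κ-step : ∀ i x → node (orbit 0 i x) i · node (orbit 0 i x) i ↦ node (orbit 0 (suc i) x) (suc i)
  κ-step i x = subst (λ h → node (orbit 0 i x) i · node (orbit 0 i x) i ↦ node h (suc i))
                     (sym (trans (orbit-last 0 i x) (cong (λ t → candidate t (orbit 0 i x)) (+-identityʳ i))))
                     (node-step (orbit 0 i x) i)

  κ-orbit : ∀ i x → KIter i (node x 0) (node (orbit 0 i x) i)
  κ-orbit zero    x = refl
  κ-orbit (suc i) x = node (orbit 0 i x) i , κ-orbit i x , κ-step i x

  κ-orbit-unique : ∀ i x {z} → KIter i (node x 0) z → z ≡ node (orbit 0 i x) i
  κ-orbit-unique zero    x refl = refl
  κ-orbit-unique (suc i) x (y , earlier , step) with κ-orbit-unique i x earlier
  ... | refl = ↦-functional step (κ-step i x)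

  node-injective : ∀ {a b} i → node a i ≡ node b i → a ≡ b
  node-injective {a} {b} i eq = cong stored (trans (sym (prog-node a i)) (trans (cong prog eq) (prog-node b i)))

  reduction : R ≤c ωω
  reduction = (λ x → node x 0) , (enc (flat startT) , start-computes) , λ x y → mk⇔ (forth x y) (back x y)
    where
    forth : ∀ x y → R x y → ωω (node x 0) (node y 0)
    forth x y r with meet (suc (x + y)) 0 x y ≤-refl r
    ... | j , met = j , node (orbit 0 j x) j , κ-orbit j x , subst (λ h → KIter j (node y 0) (node h j)) (sym met) (κ-orbit j y)

    back : ∀ x y → ωω (node x 0) (node y 0) → R x y
    back x y (i , z , from-x , from-y) = R-trans (orbit-R 0 i x) (subst (λ h → R h y) (sym same) (R-sym (orbit-R 0 i y)))
      where
      same : orbit 0 i x ≡ orbit 0 i y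
      same = node-injective i (trans (sym (κ-orbit-unique i x from-x)) (κ-orbit-unique i y from-y))

theorem8p13 : (R : Rel ℕ 0ℓ) → IsCeer R → R ≤c ωω
theorem8p13 R ceer = Reduction.reduction R (IsCeer.isEquivalence ceer) (proj₁ (IsCeer.isCE ceer)) (proj₂ (IsCeer.isCE ceer))
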